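{- Let $\mathbf{z}_1,\ldots,\mathbf{z}_k\in\mathbb{Z}^d$, let $\mathbf{z}=\mathbf{z}_1+\cdots+\mathbf{z}_k$ and $m=\max_{1\le j\le k}\|\mathbf{z}_j\|_\infty$. Then there exists $J\subseteq\{1,\ldots,k\}$ such that $\mathbf{z}=\sum_{j\in J}\mathbf{z}_j$ and $|J|\le 2\|\mathbf{z}\|(3dm)^d$.
   Context: $\|\mathbf{x}\|=\sum_{i=1}^d|\mathbf{x}(i)|$ is the one-norm and $\|\mathbf{x}\|_\infty=\max_i|\mathbf{x}(i)|$ the infinity norm. -}

module Defs where

open import Data.Nat using (ℕ; zero; suc; _⊔_)
open import Data.Integer using (ℤ; ∣_∣; _+_; 0ℤ)
open import Data.Fin using (Fin; zero; suc)
open import Data.Fin.Subset using (Subset; _∈_; inside; outside)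
open import Data.Vec using (lookup)
open import Data.Bool using (Bool; true; false; if_then_else_)

ℤVec : ℕ → Set
ℤVec d = Fin d → ℤ

sumℕ : ∀ {n} → (Fin n → ℕ) → ℕ
sumℕ {zero} f = 0
sumℕ {suc n} f = f zero Data.Nat.+ sumℕ (λ i → f (suc i))

maxℕ : ∀ {n} → (Fin n → ℕ) → ℕ
maxℕ {zero} f = 0
maxℕ {suc n} f = f zero ⊔ maxℕ (λ i → f (suc i))

norm1 : ∀ {d} → ℤVec d → ℕ
norm1 x = sumℕ (λ i → ∣ x i ∣)

normInf : ∀ {d} → ℤVec d → ℕ
normInf x = maxℕ (λ i → ∣ x i ∣)

0v : ∀ {d} → ℤVec d
0v _ = 0ℤ

_+v_ : ∀ {d} → ℤVec d → ℤVec d → ℤVec d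
(x +v y) i = x i + y i

sumVec : ∀ {d k} → (Fin k → ℤVec d) → ℤVec d
sumVec {d} {zero} z = 0v
sumVec {d} {suc k} z = z zero +v sumVec (λ j → z (suc j))

sumOver : ∀ {d k} → Subset k → (Fin k → ℤVec d) → ℤVec d
sumOver J z = sumVec (λ j → if lookup J j then z j else 0v)

-- Append to z₁, …, z_k the ‖z‖ unit vectors ∓e_c summing to -z: the resulting family T has
-- sum 0 and entries bounded by m. A Steinitz-type argument (Grinberg–Sevastyanov) removes the
-- elements of T one at a time so that every intermediate sum has infinity norm at most md: keep
-- weights μ ∈ [0,1]^A with Σ μ_i v_i = 0 and Σ μ_i = |A| - d; shrinking Σ μ by one and moving to
-- a vertex of this polytope (at most d + 1 fractional coordinates) forces some μ_i = 0 with
-- i ∈ A, and i can be dropped. Along the |T| + 1 stages the pair (number of unit vectors left,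
-- current sum) takes at most (‖z‖ + 1)(2md + 1)^d values, so if |J| exceeds that, two stages
-- agree and their difference is a nonempty zero-sum subfamily of the z_j, j ∈ J, which can be
-- removed from J. Start from J = {1, …, k} and stop once |J| ≤ 2‖z‖(3dm)^d.
module Submission where

open import Data.Fin.Base using (Fin)
open import Data.Nat.Base using (ℕ)
open import Data.Rational.Base using (ℚ)
open import Data.Vec.Functional using (Vector)

module Basics where

  open import Data.Bool.Base using (true)
  open import Data.Fin.Base using (zero; suc)
  open import Data.Fin.Properties using (any?)
  open import Data.Nat.Base as ℕ using ()
  open import Data.Nat.Induction using (<-wellFounded)
  import Data.Nat.Properties as ℕ
  open import Data.Product.Base using (∃; _×_; _,_)
  open import Data.Rational.Base using (_≤_)
  open import Data.Rational.Properties using (_≤?_; ≤-refl; ≤-trans; <⇒≤; ≰⇒>)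
  open import Function.Base using (_∘_)
  open import Induction.WellFounded using (module All)
  open import Level using (_⊔_)
  open import Relation.Binary.Construct.On as On using ()
  open import Relation.Binary.PropositionalEquality using (_≡_)
  open import Relation.Nullary.Decidable using (Dec; does; yes; no)
  open import Relation.Nullary.Negation using (contradiction)
  open import Relation.Unary using (Pred; Decidable)

  does-true⇒ : ∀ {a} {A : Set a} (a? : Dec A) → does a? ≡ true → A
  does-true⇒ (yes a) _ = a

  descend : ∀ {a p} {X : Set a} (P : Pred X p) (μ : X → ℕ) (b : ℕ) →
    (∀ x → P x → b ℕ.< μ x → ∃ λ y → P y × μ y ℕ.< μ x) →
    ∀ x → P x → ∃ λ y → P y × μ y ℕ.≤ b
  descend {a} {p} P μ b step = All.wfRec (On.wellFounded μ <-wellFounded) (a ⊔ p) Goal go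
    where
    Goal : Pred _ (a ⊔ p)
    Goal x = P x → ∃ λ y → P y × μ y ℕ.≤ b
    go : ∀ x → (∀ {y} → μ y ℕ.< μ x → Goal y) → Goal x
    go x rec Px with b ℕ.<? μ x
    ... | no b≮μx = x , Px , ℕ.≮⇒≥ b≮μx
    ... | yes b<μx with (y , Py , μy<μx) ← step x Px b<μx = rec μy<μx Py

  ∸-suc-< : ∀ {m} k → 0 ℕ.< m → m ℕ.∸ ℕ.suc k ℕ.< m
  ∸-suc-< {ℕ.suc m} k _ = ℕ.s≤s (ℕ.m∸n≤m m k)

  argmin : ∀ {n p} {P : Pred (Fin n) p} → Decidable P → (g : Fin n → ℚ) → ∃ P →
    ∃ λ j → P j × (∀ i → P i → g j ≤ g i)
  argmin {ℕ.suc n} P? g (i , Pi) with any? (P? ∘ suc)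
  argmin P? g (zero , P0) | no ¬P∘suc = zero , P0 , λ { zero _ → ≤-refl ; (suc i) Psi → contradiction (i , Psi) ¬P∘suc }
  argmin P? g (suc i , Psi) | no ¬P∘suc = contradiction (i , Psi) ¬P∘suc
  ... | yes ∃P∘suc with argmin (P? ∘ suc) (g ∘ suc) ∃P∘suc | P? zero
  ...   | j , Psj , min | no ¬P0 = suc j , Psj , λ { zero P0 → contradiction P0 ¬P0 ; (suc i) → min i }
  ...   | j , Psj , min | yes P0 with g zero ≤? g (suc j)
  ...     | yes g0≤ = zero , P0 , λ { zero _ → ≤-refl ; (suc i) Psi → ≤-trans g0≤ (min i Psi) }
  ...     | no g0≰ = suc j , Psj , λ { zero _ → <⇒≤ (≰⇒> g0≰) ; (suc i) → min i }

module Masks where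

  open import Algebra.Bundles using (CommutativeMonoid)
  open import Data.Bool.Base using (Bool; true; false; if_then_else_; _∧_; not)
  open import Data.Fin.Base using (zero; suc; _↑ˡ_; _↑ʳ_)
  open import Data.Fin.Properties using (_≟_)
  open import Data.Nat.Base using (zero; suc; _+_; _≤_; _<_; z≤n; s≤s)
  open import Data.Nat.Properties
    using (+-0-commutativeMonoid; +-comm; m≤n+m; m<m+n; +-monoˡ-<; +-mono-≤; ≤-reflexive; +-cancelʳ-<; <⇒≢)
  open import Data.Product.Base using (∃; _,_)
  open import Data.Vec.Functional.Properties using (lookup-++ˡ; lookup-++ʳ)
  open import Data.Vec.Functional using (_++_)
  open import Function.Base using (_∘_; const)
  open import Relation.Binary.PropositionalEquality using (_≡_; refl; cong; cong₂)
  open import Relation.Nullary.Decidable using (does; yes; dec-true; dec-false)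
  open import Relation.Nullary.Negation using (contradiction)

  infix 4 _⊆_
  infixl 6 _∩_ _∖_

  Mask : ℕ → Set
  Mask n = Fin n → Bool

  _⊆_ : ∀ {n} → Mask n → Mask n → Set
  B ⊆ A = ∀ i → B i ≡ true → A i ≡ true

  _∩_ : ∀ {n} → Mask n → Mask n → Mask n
  (A ∩ B) i = A i ∧ B i

  _∖_ : ∀ {n} → Mask n → Mask n → Mask n
  (A ∖ B) i = A i ∧ not (B i)

  ⁅_⁆ : ∀ {n} → Fin n → Mask n
  ⁅ i ⁆ j = does (i ≟ j)

  ⊆-trans : ∀ {n} {A B C : Mask n} → A ⊆ B → B ⊆ C → A ⊆ C
  ⊆-trans A⊆B B⊆C i = B⊆C i ∘ A⊆B i

  ∩-⊆ˡ : ∀ {n} (A B : Mask n) → A ∩ B ⊆ A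
  ∩-⊆ˡ A B i h with A i
  ... | true = refl

  ∩-⊆ʳ : ∀ {n} (A B : Mask n) → A ∩ B ⊆ B
  ∩-⊆ʳ A B i h with A i
  ... | true = h

  ∩-monoˡ : ∀ {n} {A B : Mask n} (C : Mask n) → B ⊆ A → B ∩ C ⊆ A ∩ C
  ∩-monoˡ {B = B} C B⊆A i h with B i in Bi
  ... | true rewrite B⊆A i Bi = h

  ∖-⊆ : ∀ {n} (A B : Mask n) → A ∖ B ⊆ A
  ∖-⊆ A B i h with A i
  ... | true = refl

  ∖-true : ∀ {n} {A B : Mask n} {i} → (A ∖ B) i ≡ true → B i ≡ false
  ∖-true {A = A} {B} {i} h with A i | B i
  ... | true | false = refl

  module MaskedSum {c ℓ} (M : CommutativeMonoid c ℓ) where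

    open CommutativeMonoid M hiding (refl)
    open import Algebra.Properties.CommutativeMonoid.Sum M
      using (sum; sum-cong-≗; sum-cong-≋; ∑-distrib-+; sum-replicate-zero) public

    ∑⟨_⟩_ : ∀ {n} → Mask n → Vector Carrier n → Carrier
    ∑⟨ A ⟩ f = sum (λ i → if A i then f i else ε)

    ∑⟨⟩-cong : ∀ {n} {A B : Mask n} {f g : Vector Carrier n} → (∀ i → A i ≡ B i) → (∀ i → f i ≡ g i) →
      ∑⟨ A ⟩ f ≡ ∑⟨ B ⟩ g
    ∑⟨⟩-cong {n} A≗B f≗g = sum-cong-≗ {n} (λ i → cong₂ (if_then_else ε) (A≗B i) (f≗g i))

    ∑⟨∅⟩ : ∀ {n} (f : Vector Carrier n) → ∑⟨ const false ⟩ f ≈ ε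
    ∑⟨∅⟩ {n} f = sum-replicate-zero n

    sum-↑ : ∀ {m n} (h : Vector Carrier (m + n)) → sum h ≈ sum (λ j → h (j ↑ˡ n)) ∙ sum (λ j → h (m ↑ʳ j))
    sum-↑ {zero} h = sym (identityˡ (sum h))
    sum-↑ {suc m} {n} h = trans (∙-congˡ (sum-↑ {m} {n} (h ∘ suc))) (sym (assoc _ _ _))

    ∑⟨⟩-∖ : ∀ {n} {A B : Mask n} (f : Vector Carrier n) → B ⊆ A → ∑⟨ A ⟩ f ≈ ∑⟨ A ∖ B ⟩ f ∙ ∑⟨ B ⟩ f
    ∑⟨⟩-∖ {n} {A} {B} f B⊆A = trans (sum-cong-≋ {n} pointwise) (∑-distrib-+ {n} _ _)
      where
      pointwise : ∀ i → (if A i then f i else ε) ≈ (if (A ∖ B) i then f i else ε) ∙ (if B i then f i else ε)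
      pointwise i with B i in Bi
      ... | true rewrite B⊆A i Bi = sym (identityˡ (f i))
      ... | false with A i
      ...   | true = sym (identityʳ (f i))
      ...   | false = sym (identityˡ ε)

  open import Relation.Binary.PropositionalEquality using (sym; trans; subst)

  ⁅i⁆i : ∀ {n} (i : Fin n) → ⁅ i ⁆ i ≡ true
  ⁅i⁆i i = dec-true (i ≟ i) refl

  ⁅⁆-outside : ∀ {n} {A : Mask n} {i j} → A i ≡ true → A j ≡ false → ⁅ i ⁆ j ≡ false
  ⁅⁆-outside {i = i} {j} Ai Aj = dec-false (i ≟ j) λ { refl → contradiction (trans (sym Ai) Aj) λ () }

  module ℕΣ = MaskedSum +-0-commutativeMonoid

  count : ∀ {n} → Mask n → ℕ
  count A = ℕΣ.∑⟨ A ⟩ const 1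

  count-cong : ∀ {n} {A B : Mask n} → (∀ i → A i ≡ B i) → count A ≡ count B
  count-cong A≗B = ℕΣ.∑⟨⟩-cong A≗B (λ _ → refl)

  count-∅ : ∀ n → count {n} (const false) ≡ 0
  count-∅ zero = refl
  count-∅ (suc n) = count-∅ n

  count-full : ∀ n → count {n} (const true) ≡ n
  count-full zero = refl
  count-full (suc n) = cong suc (count-full n)

  count-⁅⁆ : ∀ {n} (i : Fin n) → count ⁅ i ⁆ ≡ 1
  count-⁅⁆ {suc n} zero = cong suc (count-∅ n)
  count-⁅⁆ (suc i) = count-⁅⁆ i

  count-++ : ∀ {m n} (A : Mask m) (B : Mask n) → count (A ++ B) ≡ count A + count B
  count-++ {m} A B = trans (ℕΣ.sum-↑ {m} _) (cong₂ _+_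
    (ℕΣ.sum-cong-≗ (cong (if_then 1 else 0) ∘ lookup-++ˡ A B)) (ℕΣ.sum-cong-≗ (cong (if_then 1 else 0) ∘ lookup-++ʳ A B)))

  count-∖ : ∀ {n} {A B : Mask n} → B ⊆ A → count A ≡ count (A ∖ B) + count B
  count-∖ = ℕΣ.∑⟨⟩-∖ (const 1)

  count-remove : ∀ {n} {A : Mask n} {i} → A i ≡ true → count A ≡ suc (count (A ∖ ⁅ i ⁆))
  count-remove {A = A} {i} Ai = trans (count-∖ ⁅i⁆⊆A) (trans (cong (count (A ∖ ⁅ i ⁆) +_) (count-⁅⁆ i)) (+-comm _ 1))
    where
    ⁅i⁆⊆A : ⁅ i ⁆ ⊆ A
    ⁅i⁆⊆A j i≡j with i ≟ j
    ⁅i⁆⊆A j i≡j | yes refl = Ai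

  count-mono : ∀ {n} {A B : Mask n} → B ⊆ A → count B ≤ count A
  count-mono {A = A} {B} B⊆A = subst (count B ≤_) (sym (count-∖ {A = A} B⊆A)) (m≤n+m _ _)

  ∈⇒count-pos : ∀ {n} {A : Mask n} {i} → A i ≡ true → 0 < count A
  ∈⇒count-pos {A = A} Ai = subst (0 <_) (sym (count-remove {A = A} Ai)) (s≤s z≤n)

  count-pos⇒∈ : ∀ {n} (A : Mask n) → 0 < count A → ∃ λ i → A i ≡ true
  count-pos⇒∈ {suc n} A pos with A zero in A0
  ... | true = zero , A0
  ... | false with (i , Ai) ← count-pos⇒∈ (A ∘ suc) pos = suc i , Ai

  count-strict : ∀ {n} {A B : Mask n} {j} → B ⊆ A → A j ≡ true → B j ≡ false → count B < count A
  count-strict {A = A} {B} {j} B⊆A Aj Bj =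
    subst (count B <_) (sym (count-∖ B⊆A)) (+-monoˡ-< (count B) (∈⇒count-pos {A = A ∖ B} A∖Bj))
    where
    A∖Bj : (A ∖ B) j ≡ true
    A∖Bj rewrite Aj | Bj = refl

  count-∖-< : ∀ {n} {A B : Mask n} {i} → B ⊆ A → B i ≡ true → count (A ∖ B) < count A
  count-∖-< {A = A} {B} B⊆A Bi =
    subst (count (A ∖ B) <_) (sym (count-∖ B⊆A)) (m<m+n (count (A ∖ B)) (∈⇒count-pos {A = B} Bi))

  count-≤-∖ : ∀ {n} (A B : Mask n) → count A ≤ count (A ∖ B) + count B
  count-≤-∖ A B = subst (_≤ count (A ∖ B) + count B) (sym (count-∖ (∩-⊆ˡ A B)))
    (+-mono-≤ (≤-reflexive (count-cong ∖-∩)) (count-mono {A = B} (∩-⊆ʳ A B)))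
    where
    ∖-∩ : ∀ i → (A ∖ (A ∩ B)) i ≡ (A ∖ B) i
    ∖-∩ i with A i
    ... | true = refl
    ... | false = refl

  count-<⇒∃ : ∀ {n} {A B : Mask n} → B ⊆ A → count B < count A → ∃ λ i → (A ∖ B) i ≡ true
  count-<⇒∃ {A = A} {B} B⊆A ∣B∣<∣A∣ =
    count-pos⇒∈ (A ∖ B) (+-cancelʳ-< (count B) 0 (count (A ∖ B)) (subst (count B <_) (count-∖ {A = A} B⊆A) ∣B∣<∣A∣))

  count-≡⇒⊇ : ∀ {n} {A B : Mask n} → B ⊆ A → count B ≡ count A → A ⊆ B
  count-≡⇒⊇ {A = A} {B} B⊆A ∣B∣≡∣A∣ i Ai with B i in Bi
  ... | true = refl
  ... | false = contradiction ∣B∣≡∣A∣ (<⇒≢ (count-strict {A = A} B⊆A Ai Bi))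

module Rationals where

  open import Algebra.Bundles using (CommutativeRing)
  open import Data.Bool.Base using (Bool; true; false; if_then_else_)
  open import Data.Fin.Base using (zero; suc)
  open import Data.Integer.Base as ℤ using (ℤ; -[1+_])
  import Data.Integer.Properties as ℤ
  import Data.Nat.Base as ℕ
  open import Data.Rational.Base
  open import Data.Rational.Literals using (fromℤ)
  open import Data.Rational.Properties
  import Data.Rational.Unnormalised.Base as ℚᵘ
  import Data.Rational.Unnormalised.Properties as ℚᵘ
  open import Function.Base using (_∘_)
  open import Relation.Binary.Definitions using (tri<; tri≈; tri>)
  open import Relation.Binary.PropositionalEquality
  open import Relation.Nullary.Negation using (contradiction)

  open Masks

  ι : ℤ → ℚ
  ι = fromℤ

  fromℕ : ℕ → ℚ
  fromℕ n = ι (ℤ.+ n)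

  ι-+ : ∀ a b → ι (a ℤ.+ b) ≡ ι a + ι b
  ι-+ a b = toℚᵘ-injective (ℚᵘ.≃-trans (ℚᵘ.*≡* eq) (ℚᵘ.≃-sym (toℚᵘ-homo-+ (ι a) (ι b))))
    where
    eq : (a ℤ.+ b) ℤ.* ℤ.1ℤ ≡ (a ℤ.* ℤ.1ℤ ℤ.+ b ℤ.* ℤ.1ℤ) ℤ.* ℤ.1ℤ
    eq = trans (ℤ.*-identityʳ _) (sym (trans (ℤ.*-identityʳ _) (cong₂ ℤ._+_ (ℤ.*-identityʳ a) (ℤ.*-identityʳ b))))

  ι-* : ∀ a b → ι (a ℤ.* b) ≡ ι a * ι b
  ι-* a b = toℚᵘ-injective (ℚᵘ.≃-sym (toℚᵘ-homo-* (ι a) (ι b)))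

  ι-mono-≤ : ∀ {a b} → a ℤ.≤ b → ι a ≤ ι b
  ι-mono-≤ {a} {b} a≤b = *≤* (subst₂ ℤ._≤_ (sym (ℤ.*-identityʳ a)) (sym (ℤ.*-identityʳ b)) a≤b)

  ι-cancel-≤ : ∀ {a b} → ι a ≤ ι b → a ℤ.≤ b
  ι-cancel-≤ {a} {b} (*≤* p) = subst₂ ℤ._≤_ (ℤ.*-identityʳ a) (ℤ.*-identityʳ b) p

  ι-cancel-< : ∀ {a b} → ι a < ι b → a ℤ.< b
  ι-cancel-< {a} {b} (*<* p) = subst₂ ℤ._<_ (ℤ.*-identityʳ a) (ℤ.*-identityʳ b) p

  ∣ι∣ : ∀ a → ∣ ι a ∣ ≡ fromℕ ℤ.∣ a ∣
  ∣ι∣ (ℤ.+ n) = refl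
  ∣ι∣ -[1+ n ] = refl

  fromℕ-+ : ∀ a b → fromℕ (a ℕ.+ b) ≡ fromℕ a + fromℕ b
  fromℕ-+ a b = trans (cong ι (ℤ.pos-+ a b)) (ι-+ (ℤ.+ a) (ℤ.+ b))

  fromℕ-* : ∀ a b → fromℕ (a ℕ.* b) ≡ fromℕ a * fromℕ b
  fromℕ-* a b = trans (cong ι (ℤ.pos-* a b)) (ι-* (ℤ.+ a) (ℤ.+ b))

  fromℕ-mono-≤ : ∀ {a b} → a ℕ.≤ b → fromℕ a ≤ fromℕ b
  fromℕ-mono-≤ a≤b = ι-mono-≤ (ℤ.+≤+ a≤b)

  fromℕ-cancel-≤ : ∀ {a b} → fromℕ a ≤ fromℕ b → a ℕ.≤ b
  fromℕ-cancel-≤ = ℤ.drop‿+≤+ ∘ ι-cancel-≤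

  fromℕ-cancel-< : ∀ {a b} → fromℕ a < fromℕ b → a ℕ.< b
  fromℕ-cancel-< = ℤ.drop‿+<+ ∘ ι-cancel-<

  0≤1 : 0ℚ ≤ 1ℚ
  0≤1 = *≤* (ℤ.+≤+ ℕ.z≤n)

  ≤∧≢⇒< : ∀ {x y} → x ≤ y → x ≢ y → x < y
  ≤∧≢⇒< {x} {y} x≤y x≢y with <-cmp x y
  ... | tri< x<y _ _ = x<y
  ... | tri≈ _ x≡y _ = contradiction x≡y x≢y
  ... | tri> _ _ y<x = contradiction (≤-<-trans x≤y y<x) (<-irrefl refl)

  ÷-cancelʳ : ∀ a b .{{_ : NonZero b}} → (a ÷ b) * b ≡ a
  ÷-cancelʳ a b = trans (*-assoc a (1/ b) b) (trans (cong (a *_) (*-inverseˡ b)) (*-identityʳ a))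

  0<1/ : ∀ b .{{_ : NonZero b}} → 0ℚ < b → 0ℚ < 1/ b
  0<1/ b 0<b = positive⁻¹ _ {{1/pos⇒pos b {{positive 0<b}}}}

  ÷-monoˡ-≤ : ∀ {a a′} b .{{_ : NonZero b}} → 0ℚ < b → a ≤ a′ → a ÷ b ≤ a′ ÷ b
  ÷-monoˡ-≤ b 0<b = *-monoʳ-≤-nonNeg (1/ b) {{nonNegative (<⇒≤ (0<1/ b 0<b))}}

  ÷-nonNeg : ∀ {a} b .{{_ : NonZero b}} → 0ℚ < b → 0ℚ ≤ a → 0ℚ ≤ a ÷ b
  ÷-nonNeg {a} b 0<b 0≤a = subst (_≤ a ÷ b) (*-zeroˡ (1/ b)) (÷-monoˡ-≤ b 0<b 0≤a)

  ÷-≤1 : ∀ {a} b .{{_ : NonZero b}} → 0ℚ < b → a ≤ b → a ÷ b ≤ 1ℚ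
  ÷-≤1 {a} b 0<b a≤b = subst (a ÷ b ≤_) (*-inverseʳ b) (÷-monoˡ-≤ b 0<b a≤b)

  sub-antimono-≤ : ∀ m {x y} → x ≤ y → m - y ≤ m - x
  sub-antimono-≤ m x≤y = +-monoʳ-≤ m (neg-antimono-≤ x≤y)

  open Masks.MaskedSum +-0-commutativeMonoid using (sum; sum-cong-≗; ∑-distrib-+) public
  open import Algebra.Properties.Semiring.Sum (CommutativeRing.semiring +-*-commutativeRing)
    using (*-distribˡ-sum; sum-replicate-zero)
  module ℤΣ = MaskedSum ℤ.+-0-commutativeMonoid

  sum-zero : ∀ n → sum {n} (λ _ → 0ℚ) ≡ 0ℚ
  sum-zero n = sum-replicate-zero n

  sum-scale : ∀ {n} x (f : Vector ℚ n) → sum (λ i → x * f i) ≡ x * sum f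
  sum-scale x f = sym (*-distribˡ-sum x f)

  sum-neg : ∀ {n} (f : Vector ℚ n) → sum (λ i → - f i) ≡ - sum f
  sum-neg {ℕ.zero} f = refl
  sum-neg {ℕ.suc n} f = trans (cong (_+_ (- f zero)) (sum-neg (f ∘ suc))) (sym (neg-distrib-+ (f zero) _))

  sum-sub : ∀ {n} (f g : Vector ℚ n) → sum (λ i → f i - g i) ≡ sum f - sum g
  sum-sub f g = trans (∑-distrib-+ f (λ i → - g i)) (cong (sum f +_) (sum-neg g))

  sum-mono-≤ : ∀ {n} {f g : Vector ℚ n} → (∀ i → f i ≤ g i) → sum f ≤ sum g
  sum-mono-≤ {ℕ.zero} f≤g = ≤-refl
  sum-mono-≤ {ℕ.suc n} f≤g = +-mono-≤ (f≤g zero) (sum-mono-≤ (f≤g ∘ suc))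

  sum-mono-< : ∀ {n} {f g : Vector ℚ n} → (∀ i → f i ≤ g i) → ∀ j → f j < g j → sum f < sum g
  sum-mono-< f≤g zero f<g = +-mono-<-≤ f<g (sum-mono-≤ (f≤g ∘ suc))
  sum-mono-< f≤g (suc j) f<g = +-mono-≤-< (f≤g zero) (sum-mono-< (f≤g ∘ suc) j f<g)

  ∣sum∣≤sum∣∣ : ∀ {n} (f : Vector ℚ n) → ∣ sum f ∣ ≤ sum (∣_∣ ∘ f)
  ∣sum∣≤sum∣∣ {ℕ.zero} f = ≤-refl
  ∣sum∣≤sum∣∣ {ℕ.suc n} f = ≤-trans (∣p+q∣≤∣p∣+∣q∣ (f zero) _) (+-monoʳ-≤ ∣ f zero ∣ (∣sum∣≤sum∣∣ (f ∘ suc)))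

  ι-sum : ∀ {n} (f : Vector ℤ n) → ι (ℤΣ.sum f) ≡ sum (ι ∘ f)
  ι-sum {ℕ.zero} f = refl
  ι-sum {ℕ.suc n} f = trans (ι-+ (f zero) _) (cong (ι (f zero) +_) (ι-sum (f ∘ suc)))

  𝟙 : Bool → ℚ
  𝟙 true = 1ℚ
  𝟙 false = 0ℚ

  ι-∑⟨⟩ : ∀ {n} (A : Mask n) (f : Vector ℤ n) → ι (ℤΣ.∑⟨ A ⟩ f) ≡ sum (λ i → 𝟙 (A i) * ι (f i))
  ι-∑⟨⟩ {n} A f = trans (ι-sum {n} _) (sum-cong-≗ {n} pointwise)
    where
    pointwise : ∀ i → ι (if A i then f i else ℤ.0ℤ) ≡ 𝟙 (A i) * ι (f i)
    pointwise i with A i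
    ... | true = sym (*-identityˡ (ι (f i)))
    ... | false = sym (*-zeroˡ (ι (f i)))

  sum-𝟙 : ∀ {n} (A : Mask n) → sum (𝟙 ∘ A) ≡ fromℕ (count A)
  sum-𝟙 {ℕ.zero} A = refl
  sum-𝟙 {ℕ.suc n} A = trans (cong (𝟙 (A zero) +_) (sum-𝟙 (A ∘ suc)))
    (sym (trans (fromℕ-+ (if A zero then 1 else 0) (count (A ∘ suc))) (cong (_+ fromℕ (count (A ∘ suc))) (head (A zero)))))
    where
    head : ∀ b → fromℕ (if b then 1 else 0) ≡ 𝟙 b
    head true = refl
    head false = refl

  sum-𝟙⁅⁆ : ∀ {n} (i : Fin n) (g : Vector ℚ n) → sum (λ j → 𝟙 (⁅ i ⁆ j) * g j) ≡ g i
  sum-𝟙⁅⁆ {ℕ.suc n} zero g = begin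
    1ℚ * g zero + sum (λ j → 0ℚ * g (suc j)) ≡⟨ cong₂ _+_ (*-identityˡ (g zero)) (sum-cong-≗ (*-zeroˡ ∘ g ∘ suc)) ⟩
    g zero + sum {n} (λ _ → 0ℚ)               ≡⟨ cong (g zero +_) (sum-zero n) ⟩
    g zero + 0ℚ                              ≡⟨ +-identityʳ (g zero) ⟩
    g zero                                   ∎
    where open ≡-Reasoning
  sum-𝟙⁅⁆ (suc i) g = trans (cong (_+ rest) (*-zeroˡ (g zero))) (trans (+-identityˡ rest) (sum-𝟙⁅⁆ i (g ∘ suc)))
    where rest = sum (λ j → 𝟙 (⁅ i ⁆ j) * g (suc j))

module LinearAlgebra where

  open import Data.Bool.Base using (true; false; _∧_; not)
  open import Data.Fin.Base using (zero; suc)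
  open import Data.Fin.Properties using (any?)
  import Data.Nat.Base as ℕ
  import Data.Nat.Properties as ℕ
  open import Data.Product.Base using (∃; _×_; _,_; proj₂)
  open import Data.Rational.Base
  import Data.Rational.Properties as ℚ
  open import Data.Rational.Properties hiding (_≟_)
  open import Data.Rational.Solver using (module +-*-Solver)
  open import Function.Base using (_∘_)
  open import Relation.Binary.PropositionalEquality
  open import Relation.Nullary.Decidable using (yes; no; _×-dec_; ¬?)
  import Data.Bool.Properties as Bool
  open import Relation.Nullary.Negation using (¬_; contradiction)

  open Masks
  open Rationals
  open +-*-Solver

  infix 8 _·_

  _·_ : ∀ {n} → Vector ℚ n → Vector ℚ n → ℚ
  κ · g = sum (λ i → κ i * g i)

  ·-add-𝟙⁅⁆ : ∀ {n} (κ g : Vector ℚ n) (c : ℚ) (i₀ : Fin n) →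
    (λ i → κ i + 𝟙 (⁅ i₀ ⁆ i) * c) · g ≡ κ · g + c * g i₀
  ·-add-𝟙⁅⁆ {n} κ g c i₀ = begin
    sum (λ i → (κ i + 𝟙 (⁅ i₀ ⁆ i) * c) * g i)       ≡⟨ sum-cong-≗ {n} (λ i → distrib (κ i) (𝟙 (⁅ i₀ ⁆ i)) c (g i)) ⟩
    sum (λ i → κ i * g i + c * (𝟙 (⁅ i₀ ⁆ i) * g i)) ≡⟨ ∑-distrib-+ {n} _ _ ⟩
    κ · g + sum (λ i → c * (𝟙 (⁅ i₀ ⁆ i) * g i))     ≡⟨ cong (κ · g +_) (trans (sum-scale {n} c _) (cong (c *_) (sum-𝟙⁅⁆ i₀ g))) ⟩
    κ · g + c * g i₀                                   ∎
    where
    open ≡-Reasoning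
    distrib : ∀ k e c g → (k + e * c) * g ≡ k * g + c * (e * g)
    distrib = solve 4 (λ k e c g → (k :+ e :* c) :* g := k :* g :+ c :* (e :* g)) refl

  ·-subˡ : ∀ {n} (f h g : Vector ℚ n) (t : ℚ) → (λ i → f i - t * h i) · g ≡ f · g - t * (h · g)
  ·-subˡ {n} f h g t = begin
    sum (λ i → (f i - t * h i) * g i)       ≡⟨ sum-cong-≗ {n} (λ i → distrib (f i) t (h i) (g i)) ⟩
    sum (λ i → f i * g i - t * (h i * g i)) ≡⟨ sum-sub {n} _ _ ⟩
    f · g - sum (λ i → t * (h i * g i))     ≡⟨ cong (_-_ (f · g)) (sum-scale {n} t _) ⟩
    f · g - t * (h · g)                     ∎
    where
    open ≡-Reasoning
    distrib : ∀ f t h g → (f - t * h) * g ≡ f * g - t * (h * g)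
    distrib = solve 4 (λ f t h g → (f :- t :* h) :* g := f :* g :- t :* (h :* g)) refl

  ·-subʳ : ∀ {n} (κ g h : Vector ℚ n) (t : ℚ) → κ · (λ i → g i - t * h i) ≡ κ · g - t * (κ · h)
  ·-subʳ {n} κ g h t = begin
    sum (λ i → κ i * (g i - t * h i))       ≡⟨ sum-cong-≗ {n} (λ i → distrib (κ i) (g i) t (h i)) ⟩
    sum (λ i → κ i * g i - t * (κ i * h i)) ≡⟨ sum-sub {n} _ _ ⟩
    κ · g - sum (λ i → t * (κ i * h i))     ≡⟨ cong (_-_ (κ · g)) (sum-scale {n} t _) ⟩
    κ · g - t * (κ · h)                     ∎
    where
    open ≡-Reasoning
    distrib : ∀ k g t h → k * (g - t * h) ≡ k * g - t * (k * h)
    distrib = solve 4 (λ k g t h → k :* (g :- t :* h) := k :* g :- t :* (k :* h)) refl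

  record KernelVector {n q} (r : Fin q → Vector ℚ n) (F : Mask n) : Set where
    field
      κ : Vector ℚ n
      supported : ∀ i → F i ≡ false → κ i ≡ 0ℚ
      nonzero : ∃ λ i → κ i ≢ 0ℚ
      orthogonal : ∀ j → κ · r j ≡ 0ℚ

  kernel-unconstrained : ∀ {n} {r : Fin 0 → Vector ℚ n} {F : Mask n} {i₀} → F i₀ ≡ true → KernelVector r F
  kernel-unconstrained {F = F} {i₀} Fi₀ = record
    { κ = 𝟙 ∘ ⁅ i₀ ⁆
    ; supported = λ i Fi → cong 𝟙 (⁅⁆-outside {A = F} Fi₀ Fi)
    ; nonzero = i₀ , λ 𝟙⁅i₀⁆i₀≡0 → contradiction (trans (sym (cong 𝟙 (⁅i⁆i i₀))) 𝟙⁅i₀⁆i₀≡0) λ ()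
    ; orthogonal = λ ()
    }

  kernel-vanishing-row : ∀ {n q} {r : Fin (ℕ.suc q) → Vector ℚ n} {F : Mask n} →
    ¬ (∃ λ i → F i ≡ true × r zero i ≢ 0ℚ) → KernelVector (r ∘ suc) F → KernelVector r F
  kernel-vanishing-row {n} {r = r} {F} row₀-vanishes 𝒦 = record
    { κ = κ
    ; supported = supported
    ; nonzero = nonzero
    ; orthogonal = λ { zero → trans (sum-cong-≗ term) (sum-zero n) ; (suc j) → orthogonal j }
    }
    where
    open KernelVector 𝒦
    term : ∀ i → κ i * r zero i ≡ 0ℚ
    term i with F i in Fi | r zero i ℚ.≟ 0ℚ
    ... | false | _ = trans (cong (_* r zero i) (supported i Fi)) (*-zeroˡ (r zero i))
    ... | true | yes r₀i≡0 = trans (cong (κ i *_) r₀i≡0) (*-zeroʳ (κ i))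
    ... | true | no r₀i≢0 = contradiction (i , Fi , r₀i≢0) row₀-vanishes

  eliminate : ∀ {n q} (r : Fin (ℕ.suc q) → Vector ℚ n) i₀ .{{_ : NonZero (r zero i₀)}} → Fin q → Vector ℚ n
  eliminate r i₀ j i = r (suc j) i - (r (suc j) i₀ ÷ r zero i₀) * r zero i

  kernel-pivot : ∀ {n q} {r : Fin (ℕ.suc q) → Vector ℚ n} {F : Mask n} {i₀} .{{_ : NonZero (r zero i₀)}} →
    F i₀ ≡ true → KernelVector (eliminate r i₀) (F ∖ ⁅ i₀ ⁆) → KernelVector r F
  kernel-pivot {r = r} {F} {i₀} Fi₀ 𝒦 = record
    { κ = κ
    ; supported = supported
    ; nonzero = nonzero
    ; orthogonal = orthogonal
    }
    where
    open KernelVector 𝒦 renaming (κ to κ′; supported to supported′; nonzero to nonzero′; orthogonal to orthogonal′)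
    a = r zero i₀
    c = - (κ′ · r zero ÷ a)
    κ : Vector ℚ _
    κ i = κ′ i + 𝟙 (⁅ i₀ ⁆ i) * c
    supported : ∀ i → F i ≡ false → κ i ≡ 0ℚ
    supported i Fi = begin
      κ′ i + 𝟙 (⁅ i₀ ⁆ i) * c
        ≡⟨ cong₂ (λ x b → x + 𝟙 b * c) (supported′ i (cong (_∧ not (⁅ i₀ ⁆ i)) Fi)) (⁅⁆-outside {A = F} Fi₀ Fi) ⟩
      0ℚ + 0ℚ * c             ≡⟨ solve 1 (λ c → con 0ℚ :+ con 0ℚ :* c := con 0ℚ) refl c ⟩
      0ℚ                      ∎
      where open ≡-Reasoning
    nonzero : ∃ λ i → κ i ≢ 0ℚ
    nonzero with (i₁ , κ′i₁≢0) ← nonzero′ = i₁ , λ κi₁≡0 → κ′i₁≢0 (trans (sym κi₁≡κ′i₁) κi₁≡0)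
      where
      F′i₁ : (F ∖ ⁅ i₀ ⁆) i₁ ≡ true
      F′i₁ with (F ∖ ⁅ i₀ ⁆) i₁ in e
      ... | true = refl
      ... | false = contradiction (supported′ i₁ e) κ′i₁≢0
      κi₁≡κ′i₁ : κ i₁ ≡ κ′ i₁
      κi₁≡κ′i₁ = trans (cong (λ b → κ′ i₁ + 𝟙 b * c) (∖-true {A = F} {B = ⁅ i₀ ⁆} F′i₁))
                        (solve 2 (λ k c → k :+ con 0ℚ :* c := k) refl (κ′ i₁) c)
    orthogonal : ∀ j → κ · r j ≡ 0ℚ
    orthogonal zero = begin
      κ · r zero                             ≡⟨ ·-add-𝟙⁅⁆ κ′ (r zero) c i₀ ⟩
      κ′ · r zero + c * a
        ≡⟨ cong (κ′ · r zero +_) (solve 3 (λ s b a → :- (s :* b) :* a := :- (s :* (b :* a))) refl (κ′ · r zero) (1/ a) a) ⟩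
      κ′ · r zero - κ′ · r zero * (1/ a * a) ≡⟨ cong (λ x → κ′ · r zero - κ′ · r zero * x) (*-inverseˡ a) ⟩
      κ′ · r zero - κ′ · r zero * 1ℚ          ≡⟨ cong (_-_ (κ′ · r zero)) (*-identityʳ (κ′ · r zero)) ⟩
      κ′ · r zero - κ′ · r zero               ≡⟨ +-inverseʳ (κ′ · r zero) ⟩
      0ℚ                                      ∎
      where open ≡-Reasoning
    orthogonal (suc j) = begin
      κ · r (suc j)                            ≡⟨ ·-add-𝟙⁅⁆ κ′ (r (suc j)) c i₀ ⟩
      κ′ · r (suc j) + c * R
        ≡⟨ cong (κ′ · r (suc j) +_) (solve 3 (λ s R b → :- (s :* b) :* R := :- (R :* b :* s)) refl (κ′ · r zero) R (1/ a)) ⟩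
      κ′ · r (suc j) - (R ÷ a) * (κ′ · r zero) ≡⟨ ·-subʳ κ′ (r (suc j)) (r zero) (R ÷ a) ⟨
      κ′ · eliminate r i₀ j                    ≡⟨ orthogonal′ j ⟩
      0ℚ                                       ∎
      where
      open ≡-Reasoning
      R = r (suc j) i₀

  kernel : ∀ {n} q (r : Fin q → Vector ℚ n) (F : Mask n) → q ℕ.< count F → KernelVector r F
  kernel ℕ.zero r F 0<∣F∣ = kernel-unconstrained (proj₂ (count-pos⇒∈ F 0<∣F∣))
  kernel (ℕ.suc q) r F q<∣F∣ with any? (λ i → (F i Bool.≟ true) ×-dec ¬? (r zero i ℚ.≟ 0ℚ))
  ... | no row₀-vanishes = kernel-vanishing-row row₀-vanishes (kernel q (r ∘ suc) F (ℕ.<-trans (ℕ.n<1+n q) q<∣F∣))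
  ... | yes (i₀ , Fi₀ , a≢0) = kernel-pivot {{≢-nonZero a≢0}} Fi₀
    (kernel q (eliminate r i₀ {{≢-nonZero a≢0}}) (F ∖ ⁅ i₀ ⁆) (ℕ.s<s⁻¹ (subst (ℕ.suc q ℕ.<_) (count-remove {A = F} Fi₀) q<∣F∣)))

module Pivot where

  open import Data.Bool.Base using (Bool; true; false; if_then_else_)
  open import Data.Product.Base using (_×_; _,_; proj₁)
  open import Data.Rational.Base
  open import Data.Rational.Properties
  import Data.Rational.Properties as ℚ
  open import Data.Rational.Solver using (module +-*-Solver)
  open import Data.Sum.Base using (inj₁; inj₂)
  open import Relation.Binary.PropositionalEquality
  open import Relation.Nullary.Decidable using (yes; no; does; _×-dec_; dec-true; dec-false)
  open import Relation.Nullary.Negation using (¬_; contradiction)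

  open Basics using (does-true⇒)
  open Rationals
  open +-*-Solver

  In01 : ℚ → Set
  In01 x = 0ℚ ≤ x × x ≤ 1ℚ

  fractional : ℚ → Bool
  fractional x = does (0ℚ <? x ×-dec x <? 1ℚ)

  fractional⇒pos : ∀ {x} → fractional x ≡ true → 0ℚ < x
  fractional⇒pos {x} h = proj₁ (does-true⇒ (0ℚ <? x ×-dec x <? 1ℚ) h)

  ¬fractional∧pos⇒≥1 : ∀ {x} → fractional x ≡ false → 0ℚ < x → 1ℚ ≤ x
  ¬fractional∧pos⇒≥1 {x} h 0<x = ≮⇒≥ λ x<1 →
    contradiction (trans (sym h) (dec-true (0ℚ <? x ×-dec x <? 1ℚ) (0<x , x<1))) λ ()

  -- Moving m ∈ [0, 1] by -t * k with t ≥ 0 leaves [0, 1] through 0 if k > 0 and through 1 if k < 0.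
  exitTarget : ℚ → ℚ
  exitTarget k = if does (0ℚ <? k) then 0ℚ else 1ℚ

  exitTarget-pos : ∀ {k} → 0ℚ < k → exitTarget k ≡ 0ℚ
  exitTarget-pos {k} 0<k = cong (if_then 0ℚ else 1ℚ) (dec-true (0ℚ <? k) 0<k)

  exitTarget-neg : ∀ {k} → ¬ 0ℚ < k → exitTarget k ≡ 1ℚ
  exitTarget-neg {k} 0≮k = cong (if_then 0ℚ else 1ℚ) (dec-false (0ℚ <? k) 0≮k)

  exitTarget-¬fractional : ∀ k → fractional (exitTarget k) ≡ false
  exitTarget-¬fractional k = cases (does (0ℚ <? k))
    where
    cases : ∀ b → fractional (if b then 0ℚ else 1ℚ) ≡ false
    cases true = refl
    cases false = refl

  exitTarget-In01 : ∀ k → In01 (exitTarget k)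
  exitTarget-In01 k = cases (does (0ℚ <? k))
    where
    cases : ∀ b → In01 (if b then 0ℚ else 1ℚ)
    cases true = ≤-refl , 0≤1
    cases false = 0≤1 , ≤-refl

  -- The value 0 at k = 0 is never used.
  exitTime : ℚ → ℚ → ℚ
  exitTime m k with k ℚ.≟ 0ℚ
  ... | yes _ = 0ℚ
  ... | no k≢0 = (m - exitTarget k) ÷ k
    where instance _ = ≢-nonZero k≢0

  exitTime-* : ∀ m {k} → k ≢ 0ℚ → exitTime m k * k ≡ m - exitTarget k
  exitTime-* m {k} k≢0 with k ℚ.≟ 0ℚ
  ... | yes k≡0 = contradiction k≡0 k≢0
  ... | no k≢0 = ÷-cancelʳ (m - exitTarget k) k
    where instance _ = ≢-nonZero k≢0

  exitTime-hits : ∀ m {k} → k ≢ 0ℚ → m - exitTime m k * k ≡ exitTarget k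
  exitTime-hits m {k} k≢0 = trans (cong (_-_ m) (exitTime-* m k≢0))
    (solve 2 (λ m e → m :- (m :- e) := e) refl m (exitTarget k))

  exitTime-nonNeg : ∀ {m k} → In01 m → k ≢ 0ℚ → 0ℚ ≤ exitTime m k
  exitTime-nonNeg {m} {k} (0≤m , m≤1) k≢0 with 0ℚ <? k
  ... | yes 0<k = *-cancelʳ-≤-pos k {{positive 0<k}} (begin
    0ℚ * k               ≡⟨ *-zeroˡ k ⟩
    0ℚ                   ≤⟨ 0≤m ⟩
    m                    ≡⟨ solve 1 (λ m → m := m :- con 0ℚ) refl m ⟩
    m - 0ℚ               ≡⟨ cong (_-_ m) (exitTarget-pos 0<k) ⟨
    m - exitTarget k     ≡⟨ exitTime-* m k≢0 ⟨
    exitTime m k * k     ∎)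
    where open ≤-Reasoning
  ... | no 0≮k = *-cancelʳ-≤-neg k {{negative (≤∧≢⇒< (≮⇒≥ 0≮k) k≢0)}} (begin
    exitTime m k * k     ≡⟨ exitTime-* m k≢0 ⟩
    m - exitTarget k     ≡⟨ cong (_-_ m) (exitTarget-neg 0≮k) ⟩
    m - 1ℚ               ≤⟨ +-monoˡ-≤ (- 1ℚ) m≤1 ⟩
    1ℚ - 1ℚ              ≡⟨ +-inverseʳ 1ℚ ⟩
    0ℚ                   ≡⟨ *-zeroˡ k ⟨
    0ℚ * k               ∎)
    where open ≤-Reasoning

  m-0*k≡m : ∀ m k → m - 0ℚ * k ≡ m
  m-0*k≡m = solve 2 (λ m k → m :- con 0ℚ :* k := m) refl

  -- t ↦ m - t * k is monotone, so on [0, T] it stays between its values m and m - T * k.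
  affine-In01 : ∀ {m k t T} → In01 m → In01 (m - T * k) → 0ℚ ≤ t → t ≤ T → In01 (m - t * k)
  affine-In01 {m} {k} {t} {T} (0≤m , m≤1) (0≤mT , mT≤1) 0≤t t≤T with ≤-total 0ℚ k
  ... | inj₁ 0≤k = ≤-trans 0≤mT (sub-antimono-≤ m (*-monoʳ-≤-nonNeg k {{nonNegative 0≤k}} t≤T))
                , ≤-trans (sub-antimono-≤ m (*-monoʳ-≤-nonNeg k {{nonNegative 0≤k}} 0≤t)) (≤-trans (≤-reflexive (m-0*k≡m m k)) m≤1)
  ... | inj₂ k≤0 = ≤-trans 0≤m (≤-trans (≤-reflexive (sym (m-0*k≡m m k))) (sub-antimono-≤ m (*-monoʳ-≤-nonPos k {{nonPositive k≤0}} 0≤t)))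
                , ≤-trans (sub-antimono-≤ m (*-monoʳ-≤-nonPos k {{nonPositive k≤0}} t≤T)) mT≤1

module Steinitz {n d : ℕ} (v : Fin n → Vector ℚ d) where

  open import Data.Bool.Base using (true; false)
  open import Data.Empty using (⊥-elim)
  open import Data.Fin.Base using (zero; suc)
  open import Data.Fin.Properties as Fin using (any?)
  open import Data.Nat.Base as ℕ using (zero; suc; _∸_)
  import Data.Nat.Properties as ℕ
  open import Data.Product.Base using (∃; _×_; _,_; proj₁; proj₂)
  open import Data.Rational.Base
  open import Data.Rational.Properties
  import Data.Rational.Properties as ℚ
  open import Data.Rational.Solver using (module +-*-Solver)
  import Data.Bool.Properties as Bool
  open import Function.Base using (_∘_; _$_; const; case_of_)
  open import Relation.Binary.PropositionalEquality
  open import Relation.Nullary.Decidable using (yes; no; _×-dec_; ¬?)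
  open import Relation.Nullary.Negation using (¬_; contradiction)

  open Basics using (descend; argmin; does-true⇒; ∸-suc-<)
  open Masks
  open Rationals
  open LinearAlgebra
  open Pivot
  open +-*-Solver

  column : Fin d → Vector ℚ n
  column c i = v i c

  record Feasible (A : Mask n) (σ : ℚ) (μ : Vector ℚ n) : Set where
    field
      nonneg : ∀ i → 0ℚ ≤ μ i
      ≤one : ∀ i → μ i ≤ 1ℚ
      supported : ∀ i → A i ≡ false → μ i ≡ 0ℚ
      balanced : ∀ c → μ · column c ≡ 0ℚ
      total : sum μ ≡ σ

  feasible-scale : ∀ {A σ μ} t → 0ℚ ≤ t → t ≤ 1ℚ → Feasible A σ μ → Feasible A (t * σ) (λ i → t * μ i)
  feasible-scale {A} {σ} {μ} t 0≤t t≤1 F = record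
    { nonneg = λ i → subst (_≤ t * μ i) (*-zeroʳ t) (*-monoˡ-≤-nonNeg t {{nonNegative 0≤t}} (nonneg i))
    ; ≤one = λ i → ≤-trans (*-monoʳ-≤-nonNeg (μ i) {{nonNegative (nonneg i)}} t≤1)
                           (subst (_≤ 1ℚ) (sym (*-identityˡ (μ i))) (≤one i))
    ; supported = λ i Ai → trans (cong (t *_) (supported i Ai)) (*-zeroʳ t)
    ; balanced = λ c → begin
        sum (λ i → t * μ i * v i c)     ≡⟨ sum-cong-≗ {n} (λ i → *-assoc t (μ i) (v i c)) ⟩
        sum (λ i → t * (μ i * v i c))   ≡⟨ sum-scale {n} t _ ⟩
        t * (μ · column c)              ≡⟨ cong (t *_) (balanced c) ⟩
        t * 0ℚ                          ≡⟨ *-zeroʳ t ⟩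
        0ℚ                              ∎
    ; total = trans (sum-scale {n} t μ) (cong (t *_) total)
    }
    where
    open Feasible F
    open ≡-Reasoning

  feasible-shrink : ∀ {A σ μ} σ′ → 0ℚ ≤ σ′ → σ′ ≤ σ → Feasible A σ μ → ∃ (Feasible A σ′)
  feasible-shrink {σ = σ} {μ} σ′ 0≤σ′ σ′≤σ F with σ ℚ.≟ 0ℚ
  ... | yes σ≡0 = μ , subst (λ s → Feasible _ s μ) (trans σ≡0 (sym (≤-antisym (subst (σ′ ≤_) σ≡0 σ′≤σ) 0≤σ′))) F
  ... | no σ≢0 = _ , subst (λ s → Feasible _ s (λ i → σ′ ÷ σ * μ i)) (÷-cancelʳ σ′ σ)
                      (feasible-scale (σ′ ÷ σ) (÷-nonNeg σ 0<σ 0≤σ′) (÷-≤1 σ 0<σ σ′≤σ) F)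
    where
    instance
      _ = ≢-nonZero σ≢0
      _ = nonNegative (≤-trans 0≤σ′ σ′≤σ)
    0<σ : 0ℚ < σ
    0<σ = positive⁻¹ σ {{nonNeg∧nonZero⇒pos σ}}

  rows : Fin (suc d) → Vector ℚ n
  rows zero = const 1ℚ
  rows (suc c) = column c

  fractionalAt : Vector ℚ n → Mask n
  fractionalAt μ = fractional ∘ μ

  pivot : ∀ {A σ μ} → Feasible A σ μ → KernelVector rows (fractionalAt μ) →
    ∃ λ μ′ → Feasible A σ μ′ × count (fractionalAt μ′) ℕ.< count (fractionalAt μ)
  pivot {A} {σ} {μ} F 𝒦 = μ′ , feasible′ , count-strict {A = fractionalAt μ} fractionalAt-shrinks (moved κj≢0) leaves-j
    where
    open Feasible F
    open KernelVector 𝒦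
    exit : Fin n → ℚ
    exit i = exitTime (μ i) (κ i)
    minimiser = argmin (λ i → ¬? (κ i ℚ.≟ 0ℚ)) exit nonzero
    j = proj₁ minimiser
    κj≢0 = proj₁ (proj₂ minimiser)
    t = exit j
    μ′ : Vector ℚ n
    μ′ i = μ i - t * κ i
    unmoved : ∀ {i} → κ i ≡ 0ℚ → μ′ i ≡ μ i
    unmoved {i} κi≡0 = trans (cong (λ k → μ i - t * k) κi≡0) (solve 2 (λ m t → m :- t :* con 0ℚ := m) refl (μ i) t)
    moved : ∀ {i} → κ i ≢ 0ℚ → fractionalAt μ i ≡ true
    moved {i} κi≢0 with fractionalAt μ i in fi
    ... | true = refl
    ... | false = contradiction (KernelVector.supported 𝒦 i fi) κi≢0
    μ′-In01 : ∀ i → In01 (μ′ i)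
    μ′-In01 i with κ i ℚ.≟ 0ℚ
    ... | yes κi≡0 = subst In01 (sym (unmoved κi≡0)) (nonneg i , ≤one i)
    ... | no κi≢0 = affine-In01 (nonneg i , ≤one i) (subst In01 (sym (exitTime-hits (μ i) κi≢0)) (exitTarget-In01 (κ i)))
                      (exitTime-nonNeg (nonneg j , ≤one j) κj≢0) (proj₂ (proj₂ minimiser) i κi≢0)
    feasible′ : Feasible A σ μ′
    feasible′ = record
      { nonneg = proj₁ ∘ μ′-In01
      ; ≤one = proj₂ ∘ μ′-In01
      ; supported = λ i Ai → let μi≡0 = Feasible.supported F i Ai in
          trans (unmoved (KernelVector.supported 𝒦 i (cong fractional μi≡0))) μi≡0
      ; balanced = λ c → begin
          μ′ · column c                   ≡⟨ ·-subˡ μ κ (column c) t ⟩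
          μ · column c - t * (κ · column c) ≡⟨ cong₂ (λ x y → x - t * y) (balanced c) (orthogonal (suc c)) ⟩
          0ℚ - t * 0ℚ                      ≡⟨ solve 1 (λ t → con 0ℚ :- t :* con 0ℚ := con 0ℚ) refl t ⟩
          0ℚ                               ∎
      ; total = begin
          sum μ′                 ≡⟨ sum-sub {n} μ (λ i → t * κ i) ⟩
          sum μ - sum (λ i → t * κ i) ≡⟨ cong₂ (λ x y → x - y) total (sum-scale {n} t κ) ⟩
          σ - t * sum κ
            ≡⟨ cong (λ x → σ - t * x) (trans (sum-cong-≗ {n} (λ i → sym (*-identityʳ (κ i)))) (orthogonal zero)) ⟩
          σ - t * 0ℚ             ≡⟨ solve 2 (λ s t → s :- t :* con 0ℚ := s) refl σ t ⟩
          σ                      ∎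
      }
      where open ≡-Reasoning
    fractionalAt-shrinks : fractionalAt μ′ ⊆ fractionalAt μ
    fractionalAt-shrinks i fi with κ i ℚ.≟ 0ℚ
    ... | yes κi≡0 = trans (cong fractional (sym (unmoved κi≡0))) fi
    ... | no κi≢0 = moved κi≢0
    leaves-j : fractionalAt μ′ j ≡ false
    leaves-j = trans (cong fractional (exitTime-hits (μ j) κj≢0)) (exitTarget-¬fractional (κ j))

  vertex : ∀ {A σ μ} → Feasible A σ μ → ∃ λ μ′ → Feasible A σ μ′ × count (fractionalAt μ′) ℕ.≤ suc d
  vertex {A} {σ} {μ} = descend (Feasible A σ) (count ∘ fractionalAt) (suc d)
    (λ μ F d<∣F∣ → pivot F (kernel (suc d) rows (fractionalAt μ) d<∣F∣)) μ

  Admissible : Mask n → Set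
  Admissible A = ∃ (Feasible A (fromℕ (count A ∸ d)))

  indicator-feasible : ∀ {A} → (∀ c → (𝟙 ∘ A) · column c ≡ 0ℚ) → Feasible A (fromℕ (count A)) (𝟙 ∘ A)
  indicator-feasible {A} balanced = record
    { nonneg = λ i → proj₁ (𝟙-In01 (A i))
    ; ≤one = λ i → proj₂ (𝟙-In01 (A i))
    ; supported = λ i Ai → cong 𝟙 Ai
    ; balanced = balanced
    ; total = sum-𝟙 A
    }
    where
    𝟙-In01 : ∀ b → In01 (𝟙 b)
    𝟙-In01 true = 0≤1 , ≤-refl
    𝟙-In01 false = ≤-refl , 0≤1

  zeroSum⇒admissible : ∀ {A} → (∀ c → (𝟙 ∘ A) · column c ≡ 0ℚ) → Admissible A
  zeroSum⇒admissible {A} balanced = feasible-shrink (fromℕ (count A ∸ d))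
    (fromℕ-mono-≤ ℕ.z≤n) (fromℕ-mono-≤ (ℕ.m∸n≤m (count A) d)) (indicator-feasible balanced)

  -- Were μ positive on all of A, its non-fractional coordinates there would all be 1, and at most
  -- d + 1 fractional ones could not bring the total down to ∣A∣ ∸ (d + 1).
  vertex-zero : ∀ {A μ} → Feasible A (fromℕ (count A ∸ suc d)) μ → count (fractionalAt μ) ℕ.≤ suc d →
    0 ℕ.< count A → ∃ λ i → A i ≡ true × μ i ≡ 0ℚ
  vertex-zero {A} {μ} F few 0<∣A∣ with any? (λ i → (A i Bool.≟ true) ×-dec (μ i ℚ.≟ 0ℚ))
  ... | yes (i , Ai , μi≡0) = i , Ai , μi≡0
  ... | no none = ⊥-elim $ case any? (λ i → fractionalAt μ i Bool.≟ true) of λ where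
      (yes (j , fj)) → ℕ.<-irrefl refl (ℕ.<-≤-trans (fromℕ-cancel-< (∣G∣<total j fj)) total≤∣G∣)
      (no no-fractional) → ℕ.<-irrefl refl
        (ℕ.<-≤-trans (∸-suc-< d 0<∣A∣) (ℕ.≤-trans (∣A∣≤∣G∣ no-fractional) (fromℕ-cancel-≤ ∣G∣≤total)))
    where
    open Feasible F
    μ-pos : ∀ i → A i ≡ true → 0ℚ < μ i
    μ-pos i Ai = ≤∧≢⇒< (nonneg i) (λ 0≡μi → none (i , Ai , sym 0≡μi))
    G = A ∖ fractionalAt μ
    𝟙G≤μ : ∀ i → 𝟙 (G i) ≤ μ i
    𝟙G≤μ i with A i in Ai | fractionalAt μ i in fi
    ... | true | false = ¬fractional∧pos⇒≥1 fi (μ-pos i Ai)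
    ... | true | true = nonneg i
    ... | false | _ = nonneg i
    ∣G∣≤total : fromℕ (count G) ≤ fromℕ (count A ∸ suc d)
    ∣G∣≤total = subst₂ _≤_ (sum-𝟙 G) total (sum-mono-≤ 𝟙G≤μ)
    ∣G∣<total : ∀ j → fractionalAt μ j ≡ true → fromℕ (count G) < fromℕ (count A ∸ suc d)
    ∣G∣<total j fj = subst₂ _<_ (sum-𝟙 G) total (sum-mono-< 𝟙G≤μ j 𝟙Gj<μj)
      where
      𝟙Gj<μj : 𝟙 (G j) < μ j
      𝟙Gj<μj rewrite fj | Bool.∧-zeroʳ (A j) = fractional⇒pos fj
    total≤∣G∣ : count A ∸ suc d ℕ.≤ count G
    total≤∣G∣ = ℕ.m≤n+o⇒m∸n≤o (count A) (suc d) (ℕ.≤-trans (count-≤-∖ A (fractionalAt μ))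
      (ℕ.≤-trans (ℕ.+-monoʳ-≤ (count G) few) (ℕ.≤-reflexive (ℕ.+-comm (count G) (suc d)))))
    ∣A∣≤∣G∣ : ¬ (∃ λ i → fractionalAt μ i ≡ true) → count A ℕ.≤ count G
    ∣A∣≤∣G∣ no-fractional = ℕ.≤-trans (count-≤-∖ A (fractionalAt μ))
      (ℕ.≤-reflexive (trans (cong (count G ℕ.+_) ∣F∣≡0) (ℕ.+-identityʳ (count G))))
      where
      ∣F∣≡0 : count (fractionalAt μ) ≡ 0
      ∣F∣≡0 = ℕ.n≤0⇒n≡0 (ℕ.≮⇒≥ (λ pos → no-fractional (count-pos⇒∈ (fractionalAt μ) pos)))

  feasible-remove : ∀ {A μ i} → Feasible A (fromℕ (count A ∸ suc d)) μ → A i ≡ true → μ i ≡ 0ℚ →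
    Feasible (A ∖ ⁅ i ⁆) (fromℕ (count (A ∖ ⁅ i ⁆) ∸ d)) μ
  feasible-remove {A} {μ} {i} F Ai μi≡0 = record
    { nonneg = nonneg ; ≤one = ≤one ; supported = supported′ ; balanced = balanced ; total = total′ }
    where
    open Feasible F
    supported′ : ∀ j → (A ∖ ⁅ i ⁆) j ≡ false → μ j ≡ 0ℚ
    supported′ j h with A j in Aj | ⁅ i ⁆ j in i≡j
    ... | false | _ = supported j Aj
    ... | true | true = subst (λ k → μ k ≡ 0ℚ) (does-true⇒ (i Fin.≟ j) i≡j) μi≡0
    total′ : sum μ ≡ fromℕ (count (A ∖ ⁅ i ⁆) ∸ d)
    total′ = trans total (cong (λ a → fromℕ (a ∸ suc d)) (count-remove {A = A} Ai))

  admissible-remove : ∀ {A} → Admissible A → 0 ℕ.< count A → ∃ λ i → A i ≡ true × Admissible (A ∖ ⁅ i ⁆)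
  admissible-remove {A} (μ , F) 0<∣A∣ = i , Ai , μ₂ , feasible-remove F₂ Ai μ₂i≡0
    where
    σ₁ = fromℕ (count A ∸ suc d)
    shrunk : ∃ (Feasible A σ₁)
    shrunk = feasible-shrink σ₁ (fromℕ-mono-≤ ℕ.z≤n) (fromℕ-mono-≤ (ℕ.∸-monoʳ-≤ (count A) (ℕ.n≤1+n d))) F
    reduced : ∃ λ μ′ → Feasible A σ₁ μ′ × count (fractionalAt μ′) ℕ.≤ suc d
    reduced = vertex (proj₂ shrunk)
    μ₂ : Vector ℚ n
    μ₂ = proj₁ reduced
    F₂ : Feasible A σ₁ μ₂
    F₂ = proj₁ (proj₂ reduced)
    zero-at : ∃ λ i → A i ≡ true × μ₂ i ≡ 0ℚ
    zero-at = vertex-zero F₂ (proj₂ (proj₂ reduced)) 0<∣A∣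
    i = proj₁ zero-at
    Ai = proj₁ (proj₂ zero-at)
    μ₂i≡0 = proj₂ (proj₂ zero-at)

  admissible-bound : ∀ {A} m → (∀ i c → ∣ v i c ∣ ≤ fromℕ m) → Admissible A →
    ∀ c → ∣ (𝟙 ∘ A) · column c ∣ ≤ fromℕ (m ℕ.* d)
  admissible-bound {A} m ∣v∣≤m (μ , F) c = begin
    ∣ (𝟙 ∘ A) · column c ∣           ≡⟨ cong ∣_∣ (sym shift) ⟩
    ∣ w · column c ∣                 ≤⟨ ∣sum∣≤sum∣∣ (λ i → w i * v i c) ⟩
    sum (λ i → ∣ w i * v i c ∣)
      ≡⟨ sum-cong-≗ {n} (λ i → trans (∣p*q∣≡∣p∣*∣q∣ (w i) (v i c)) (cong (_* ∣ v i c ∣) (0≤p⇒∣p∣≡p (w-nonneg i)))) ⟩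
    sum (λ i → w i * ∣ v i c ∣)      ≤⟨ sum-mono-≤ (λ i → *-monoˡ-≤-nonNeg (w i) {{nonNegative (w-nonneg i)}} (∣v∣≤m i c)) ⟩
    sum (λ i → w i * fromℕ m)        ≡⟨ trans (sum-cong-≗ {n} (λ i → *-comm (w i) (fromℕ m))) (sum-scale {n} (fromℕ m) w) ⟩
    fromℕ m * sum w                  ≤⟨ *-monoˡ-≤-nonNeg (fromℕ m) {{nonNegative (fromℕ-mono-≤ ℕ.z≤n)}} sum-w≤d ⟩
    fromℕ m * fromℕ d                ≡⟨ fromℕ-* m d ⟨
    fromℕ (m ℕ.* d)                  ∎
    where
    open ≤-Reasoning
    open Feasible F
    w : Vector ℚ n
    w i = 𝟙 (A i) - μ i
    w-nonneg : ∀ i → 0ℚ ≤ w i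
    w-nonneg i with A i in Ai
    ... | true = subst (_≤ 1ℚ - μ i) (+-inverseʳ (μ i)) (+-monoˡ-≤ (- μ i) (≤one i))
    ... | false = ≤-reflexive (sym (trans (cong (λ x → 0ℚ - x) (supported i Ai)) (+-inverseʳ 0ℚ)))
    shift : w · column c ≡ (𝟙 ∘ A) · column c
    shift = ≡.begin
      sum (λ i → (𝟙 (A i) - μ i) * v i c)         ≡.≡⟨ sum-cong-≗ {n} (λ i → distrib (𝟙 (A i)) (μ i) (v i c)) ⟩
      sum (λ i → 𝟙 (A i) * v i c - μ i * v i c)   ≡.≡⟨ sum-sub {n} _ _ ⟩
      (𝟙 ∘ A) · column c - μ · column c             ≡.≡⟨ cong (_-_ ((𝟙 ∘ A) · column c)) (balanced c) ⟩
      (𝟙 ∘ A) · column c - 0ℚ                       ≡.≡⟨ solve 1 (λ x → x :- con 0ℚ := x) refl _ ⟩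
      (𝟙 ∘ A) · column c                            ≡.∎
      where
      module ≡ = ≡-Reasoning
      distrib : ∀ a b x → (a - b) * x ≡ a * x - b * x
      distrib = solve 3 (λ a b x → (a :- b) :* x := a :* x :- b :* x) refl
    sum-w≤d : sum w ≤ fromℕ d
    sum-w≤d = begin
      sum w                                       ≡⟨ sum-sub {n} (𝟙 ∘ A) μ ⟩
      sum (𝟙 ∘ A) - sum μ                         ≡⟨ cong₂ _-_ (sum-𝟙 A) total ⟩
      fromℕ (count A) - fromℕ (count A ∸ d)       ≤⟨ +-monoˡ-≤ (- fromℕ (count A ∸ d)) (fromℕ-mono-≤ (ℕ.m≤n+m∸n (count A) d)) ⟩
      fromℕ (d ℕ.+ (count A ∸ d)) - fromℕ (count A ∸ d) ≡⟨ cong (_- fromℕ (count A ∸ d)) (fromℕ-+ d (count A ∸ d)) ⟩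
      fromℕ d + fromℕ (count A ∸ d) - fromℕ (count A ∸ d)
        ≡⟨ solve 2 (λ x y → x :+ y :- y := x) refl (fromℕ d) (fromℕ (count A ∸ d)) ⟩
      fromℕ d                                     ∎


module ZeroSum where

  open import Algebra.Bundles using (AbelianGroup)
  open import Data.Bool.Base using (true; false; _∧_)
  open import Data.Fin.Base using (toℕ; fromℕ<; combine; funToFin; finToFun)
  import Data.Fin.Properties as Fin
  open import Data.Integer.Base as ℤ using (ℤ; +_; -[1+_]; ∣_∣)
  import Data.Integer.Properties as ℤ
  open import Data.Nat.Base as ℕ using (zero; suc; _≤_; _<_; _∸_; _^_; z≤n; s≤s)
  import Data.Nat.Properties as ℕ
  open import Data.Product.Base using (∃; _×_; _,_; proj₁; proj₂)
  open import Function.Base using (_∘_)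
  open import Relation.Binary.PropositionalEquality
  import Data.Rational.Base as ℚ
  open import Relation.Nullary.Decidable using (yes; no)
  open import Relation.Nullary.Negation using (contradiction)
  open import Algebra.Properties.Group (AbelianGroup.group ℤ.+-0-abelianGroup) using (∙-cancelʳ)

  open Masks
  open Rationals

  digit : (R : ℕ) → ℤ → Fin (suc (R ℕ.+ R))
  digit R x = fromℕ< (s≤s (ℕ.m⊓n≤n ∣ x ℤ.+ + R ∣ (R ℕ.+ R)))

  ∣i∣≤n⇒0≤i+n : ∀ {R} i → ∣ i ∣ ≤ R → ℤ.0ℤ ℤ.≤ i ℤ.+ + R
  ∣i∣≤n⇒0≤i+n (+ k) _ = ℤ.+≤+ z≤n
  ∣i∣≤n⇒0≤i+n {R} -[1+ k ] k<R = subst (ℤ.0ℤ ℤ.≤_) (sym (ℤ.⊖-≥ k<R)) (ℤ.+≤+ z≤n)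

  digit-toℕ : ∀ {R x} → ∣ x ∣ ≤ R → + toℕ (digit R x) ≡ x ℤ.+ + R
  digit-toℕ {R} {x} ∣x∣≤R = begin
    + toℕ (digit R x)              ≡⟨ cong +_ (Fin.toℕ-fromℕ< _) ⟩
    + (∣ x ℤ.+ + R ∣ ℕ.⊓ (R ℕ.+ R)) ≡⟨ cong +_ (ℕ.m≤n⇒m⊓n≡m (ℕ.≤-trans (ℤ.∣i+j∣≤∣i∣+∣j∣ x (+ R)) (ℕ.+-monoˡ-≤ R ∣x∣≤R))) ⟩
    + ∣ x ℤ.+ + R ∣                 ≡⟨ ℤ.0≤i⇒+∣i∣≡i (∣i∣≤n⇒0≤i+n x ∣x∣≤R) ⟩
    x ℤ.+ + R                      ∎
    where open ≡-Reasoning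

  digit-injective : ∀ {R x y} → ∣ x ∣ ≤ R → ∣ y ∣ ≤ R → digit R x ≡ digit R y → x ≡ y
  digit-injective {R} {x} {y} ∣x∣≤R ∣y∣≤R eq = ∙-cancelʳ (+ R) x y
    (trans (sym (digit-toℕ {x = x} ∣x∣≤R)) (trans (cong (+_ ∘ toℕ) eq) (digit-toℕ {x = y} ∣y∣≤R)))

  encode : (R : ℕ) → ∀ {d} → (Fin d → ℤ) → Fin (suc (R ℕ.+ R) ^ d)
  encode R x = funToFin (digit R ∘ x)

  encode-injective : ∀ {R d} {x y : Fin d → ℤ} → (∀ c → ∣ x c ∣ ≤ R) → (∀ c → ∣ y c ∣ ≤ R) →
    encode R x ≡ encode R y → ∀ c → x c ≡ y c
  encode-injective {R} {x = x} {y} ∣x∣≤R ∣y∣≤R eq c = digit-injective (∣x∣≤R c) (∣y∣≤R c)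
    (trans (sym (Fin.finToFun-funToFin (digit R ∘ x) c))
           (trans (cong (λ k → finToFun k c) eq) (Fin.finToFun-funToFin (digit R ∘ y) c)))

  module ZeroSumSubset {n d : ℕ} (w : Fin n → Fin d → ℤ) (m : ℕ) (∣w∣≤m : ∀ i c → ∣ w i c ∣ ≤ m) where

    v : Fin n → Fin d → ℚ
    v i c = ι (w i c)

    open Steinitz v

    columnSum : Mask n → Fin d → ℤ
    columnSum A c = ℤΣ.∑⟨ A ⟩ (λ i → w i c)

    admissible-columnSum : ∀ {A} → Admissible A → ∀ c → ∣ columnSum A c ∣ ≤ m ℕ.* d
    admissible-columnSum {A} adm c = fromℕ-cancel-≤ (subst (ℚ._≤ fromℕ (m ℕ.* d))
      (trans (cong ℚ.∣_∣ (sym (ι-∑⟨⟩ A _))) (∣ι∣ (columnSum A c)))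
      (admissible-bound m (λ i c → subst (ℚ._≤ fromℕ m) (sym (∣ι∣ (w i c))) (fromℕ-mono-≤ (∣w∣≤m i c))) adm c))

    removeOne : ∃ Admissible → ∃ Admissible
    removeOne (A , adm) with 0 ℕ.<? count A
    ... | yes 0<∣A∣ = A ∖ ⁅ proj₁ removal ⁆ , proj₂ (proj₂ removal)
      where removal = admissible-remove adm 0<∣A∣
    ... | no _ = A , adm

    removeOne-⊆ : ∀ p → proj₁ (removeOne p) ⊆ proj₁ p
    removeOne-⊆ (A , adm) with 0 ℕ.<? count A
    ... | yes _ = ∖-⊆ A _
    ... | no _ = λ _ h → h

    removeOne-count : ∀ p → count (proj₁ (removeOne p)) ≡ count (proj₁ p) ∸ 1
    removeOne-count (A , adm) with 0 ℕ.<? count A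
    ... | yes 0<∣A∣ = sym (cong (_∸ 1) (count-remove {A = A} (proj₁ (proj₂ (admissible-remove adm 0<∣A∣)))))
    ... | no ¬0<∣A∣ = trans ∣A∣≡0 (cong (_∸ 1) (sym ∣A∣≡0))
      where ∣A∣≡0 = ℕ.n≤0⇒n≡0 (ℕ.≮⇒≥ ¬0<∣A∣)

    peel : ∃ Admissible → ℕ → ∃ Admissible
    peel p zero = p
    peel p (suc k) = removeOne (peel p k)

    peel-count : ∀ p k → count (proj₁ (peel p k)) ≡ count (proj₁ p) ∸ k
    peel-count p zero = refl
    peel-count p (suc k) = begin
      count (proj₁ (removeOne (peel p k))) ≡⟨ removeOne-count (peel p k) ⟩
      count (proj₁ (peel p k)) ∸ 1    ≡⟨ cong (_∸ 1) (peel-count p k) ⟩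
      count (proj₁ p) ∸ k ∸ 1            ≡⟨ ℕ.∸-+-assoc (count (proj₁ p)) k 1 ⟩
      count (proj₁ p) ∸ (k ℕ.+ 1)        ≡⟨ cong (count (proj₁ p) ∸_) (ℕ.+-comm k 1) ⟩
      count (proj₁ p) ∸ suc k            ∎
      where open ≡-Reasoning

    peel-⊆ : ∀ p {k l} → k ≤ l → proj₁ (peel p l) ⊆ proj₁ (peel p k)
    peel-⊆ p {k} {l} k≤l = subst (λ l → proj₁ (peel p l) ⊆ proj₁ (peel p k)) (ℕ.m∸n+n≡m k≤l) (later (l ∸ k))
      where
      later : ∀ δ → proj₁ (peel p (δ ℕ.+ k)) ⊆ proj₁ (peel p k)
      later zero = λ _ h → h
      later (suc δ) = ⊆-trans (removeOne-⊆ (peel p (δ ℕ.+ k))) (later δ)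

    R : ℕ
    R = m ℕ.* d

    zeroSum-avoiding : ∀ (T U : Mask n) → (∀ c → columnSum T c ≡ ℤ.0ℤ) →
      suc (count U) ℕ.* suc (R ℕ.+ R) ^ d < suc (count T) →
      ∃ λ D → D ⊆ T × (∀ i → D i ≡ true → U i ≡ false) × (∃ λ i → D i ≡ true) × (∀ c → columnSum D c ≡ ℤ.0ℤ)
    zeroSum-avoiding T U T-zero few-classes = D , D⊆T , D-avoids-U , nonempty , D-zero
      where
      start : ∃ Admissible
      start = T , zeroSum⇒admissible (λ c → trans (sym (ι-∑⟨⟩ T _)) (cong ι (T-zero c)))
      B : ℕ → Mask n
      B k = proj₁ (peel start k)
      class : ℕ → Fin (suc (count U) ℕ.* suc (R ℕ.+ R) ^ d)
      class k = combine (fromℕ< (s≤s (count-mono {A = U} (∩-⊆ʳ (B k) U)))) (encode R (columnSum (B k)))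
      collision = Fin.pigeonhole few-classes (class ∘ toℕ)
      a = toℕ (proj₁ collision)
      b = toℕ (proj₁ (proj₂ collision))
      a<b : a < b
      a<b = proj₁ (proj₂ (proj₂ collision))
      same-class = Fin.combine-injective _ _ _ _ (proj₂ (proj₂ (proj₂ collision)))
      Bb⊆Ba : B b ⊆ B a
      Bb⊆Ba = peel-⊆ start (ℕ.<⇒≤ a<b)
      same-sums : ∀ c → columnSum (B a) c ≡ columnSum (B b) c
      same-sums = encode-injective (admissible-columnSum (proj₂ (peel start a)))
                                   (admissible-columnSum (proj₂ (peel start b))) (proj₂ same-class)
      same-count : count (B b ∩ U) ≡ count (B a ∩ U)
      same-count = sym (trans (sym (Fin.toℕ-fromℕ< _)) (trans (cong toℕ (proj₁ same-class)) (Fin.toℕ-fromℕ< _)))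
      D = B a ∖ B b
      D⊆T : D ⊆ T
      D⊆T = ⊆-trans (∖-⊆ (B a) (B b)) (peel-⊆ start {0} {a} z≤n)
      D-zero : ∀ c → columnSum D c ≡ ℤ.0ℤ
      D-zero c = ∙-cancelʳ (columnSum (B b) c) _ _
        (trans (sym (ℤΣ.∑⟨⟩-∖ (λ i → w i c) Bb⊆Ba)) (trans (same-sums c) (sym (ℤ.+-identityˡ _))))
      nonempty : ∃ λ i → D i ≡ true
      nonempty = count-<⇒∃ Bb⊆Ba (subst₂ _<_ (sym (peel-count start b)) (sym (peel-count start a))
                                          (ℕ.∸-monoʳ-< a<b (ℕ.s≤s⁻¹ (Fin.toℕ<n (proj₁ (proj₂ collision))))))
      D-avoids-U : ∀ i → D i ≡ true → U i ≡ false
      D-avoids-U i Di with U i in Ui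
      ... | false = refl
      ... | true = contradiction (trans (sym Bbi) (∖-true {A = B a} {B = B b} Di)) λ ()
        where
        Bbi : B b i ≡ true
        Bbi = ∩-⊆ˡ (B b) U i (count-≡⇒⊇ (∩-monoˡ U Bb⊆Ba) same-count i (cong₂ _∧_ (∖-⊆ (B a) (B b) i Di) Ui))


open import Defs
open import Data.Bool.Base using (true; false; if_then_else_)
open import Data.Fin.Base using (Fin; zero; suc; splitAt; _↑ˡ_; _↑ʳ_)
open import Data.Fin.Subset using (Subset; ∣_∣)
open import Data.Integer.Base as ℤ using (ℤ; +_; -[1+_]; 0ℤ)
import Data.Integer.Properties as ℤ
open import Data.Nat.Base as ℕ using (ℕ; zero; suc; _+_; _*_; _^_; _≤_; _<_; z≤n; s≤s)
import Data.Nat.Properties as ℕ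
open import Data.Product.Base using (∃; ∃-syntax; _×_; _,_; proj₁; proj₂)
open import Data.Sum.Base using (inj₁; inj₂)
open import Data.Vec.Base using (tabulate; lookup)
open import Data.Vec.Functional using (_∷_; _++_)
open import Data.Vec.Functional.Properties using (lookup-++ˡ; lookup-++ʳ)
open import Data.Vec.Properties using (lookup∘tabulate)
open import Function.Base using (_∘_; const)
open import Relation.Binary.PropositionalEquality
  using (_≡_; _≢_; refl; sym; trans; cong; cong₂; subst; subst₂; module ≡-Reasoning)
open import Data.Nat.Solver using (module +-*-Solver)

open Masks
open ZeroSum using (module ZeroSumSubset)
import Data.Fin.Properties as Fin
open import Relation.Nullary.Negation using (contradiction)
open import Relation.Nullary.Decidable using (yes; no)
open Basics using (descend)
open Rationals using (module ℤΣ)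

sumVec-columns : ∀ {d k} (z : Fin k → ℤVec d) c → sumVec z c ≡ ℤΣ.sum (λ j → z j c)
sumVec-columns {k = zero} z c = refl
sumVec-columns {k = suc k} z c = cong (ℤ._+_ (z zero c)) (sumVec-columns (z ∘ suc) c)

sumOver-columns : ∀ {d k} (J : Subset k) (z : Fin k → ℤVec d) c → sumOver J z c ≡ ℤΣ.∑⟨ lookup J ⟩ (λ j → z j c)
sumOver-columns {k = k} J z c = trans (sumVec-columns (λ j → if lookup J j then z j else 0v) c) (ℤΣ.sum-cong-≗ {k} pointwise)
  where
  pointwise : ∀ j → (if lookup J j then z j else 0v) c ≡ (if lookup J j then z j c else 0ℤ)
  pointwise j with lookup J j
  ... | true = refl
  ... | false = refl

∣tabulate∣ : ∀ {k} (A : Mask k) → ∣ tabulate A ∣ ≡ count A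
∣tabulate∣ {zero} A = refl
∣tabulate∣ {suc k} A with A zero
... | true = cong suc (∣tabulate∣ (A ∘ suc))
... | false = ∣tabulate∣ (A ∘ suc)

sum-const : ∀ n x → ℤΣ.sum {n} (const x) ≡ + n ℤ.* x
sum-const zero x = sym (ℤ.*-zeroˡ x)
sum-const (suc n) x = trans (cong (ℤ._+_ x) (sum-const n x)) (sym (ℤ.suc-* (+ n) x))

-- Agrees with -signum except at 0, where its value is never used.
negSignum : ℤ → ℤ
negSignum (+ _) = ℤ.-1ℤ
negSignum -[1+ _ ] = ℤ.1ℤ

∣i∣*negSignum : ∀ x → + ℤ.∣ x ∣ ℤ.* negSignum x ≡ ℤ.- x
∣i∣*negSignum (+ n) = trans (ℤ.*-comm (+ n) ℤ.-1ℤ) (ℤ.-1*i≡-i (+ n))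
∣i∣*negSignum -[1+ n ] = ℤ.*-identityʳ _

unitSteps : ∀ {d} (s : ℤVec d) → Fin (norm1 s) → ℤVec d
unitSteps {zero} s ()
unitSteps {suc d} s = (λ _ → negSignum (s zero) ∷ const 0ℤ) ++ (λ j → 0ℤ ∷ unitSteps (s ∘ suc) j)

unitSteps-sum : ∀ {d} (s : ℤVec d) c → ℤΣ.sum (λ j → unitSteps s j c) ≡ ℤ.- s c
unitSteps-sum {suc d} s c = trans (ℤΣ.sum-↑ {ℤ.∣ s zero ∣} _) (trans (cong₂ ℤ._+_
  (ℤΣ.sum-cong-≗ (λ j → cong (λ v → v c) (lookup-++ˡ first rest j)))
  (ℤΣ.sum-cong-≗ (λ j → cong (λ v → v c) (lookup-++ʳ first rest j)))) (blocks c))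
  where
  first : Fin ℤ.∣ s zero ∣ → ℤVec (suc d)
  first _ = negSignum (s zero) ∷ const 0ℤ
  rest : Fin (norm1 (s ∘ suc)) → ℤVec (suc d)
  rest j = 0ℤ ∷ unitSteps (s ∘ suc) j
  blocks : ∀ c → ℤΣ.sum (λ j → first j c) ℤ.+ ℤΣ.sum (λ j → rest j c) ≡ ℤ.- s c
  blocks zero = begin
    ℤΣ.sum {ℤ.∣ s zero ∣} (const (negSignum (s zero))) ℤ.+ ℤΣ.sum {norm1 (s ∘ suc)} (const 0ℤ)
      ≡⟨ cong₂ ℤ._+_ (sum-const ℤ.∣ s zero ∣ _) (sum-const (norm1 (s ∘ suc)) 0ℤ) ⟩
    + ℤ.∣ s zero ∣ ℤ.* negSignum (s zero) ℤ.+ + norm1 (s ∘ suc) ℤ.* 0ℤ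
      ≡⟨ cong₂ ℤ._+_ (∣i∣*negSignum (s zero)) (ℤ.*-zeroʳ (+ norm1 (s ∘ suc))) ⟩
    ℤ.- s zero ℤ.+ 0ℤ ≡⟨ ℤ.+-identityʳ (ℤ.- s zero) ⟩
    ℤ.- s zero ∎
    where open ≡-Reasoning
  blocks (suc c) = trans (cong (ℤ._+ ℤΣ.sum (λ j → rest j (suc c)))
                               (trans (sum-const ℤ.∣ s zero ∣ 0ℤ) (ℤ.*-zeroʳ (+ ℤ.∣ s zero ∣))))
                         (trans (ℤ.+-identityˡ (ℤΣ.sum (λ j → rest j (suc c)))) (unitSteps-sum (s ∘ suc) c))

unitSteps-bound : ∀ {d} (s : ℤVec d) j c → ℤ.∣ unitSteps s j c ∣ ≤ 1
unitSteps-bound {suc d} s j c with splitAt ℤ.∣ s zero ∣ j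
unitSteps-bound {suc d} s j zero | inj₁ _ with s zero
... | + _ = ℕ.≤-refl
... | -[1+ _ ] = ℕ.≤-refl
unitSteps-bound {suc d} s j (suc c) | inj₁ _ = z≤n
unitSteps-bound {suc d} s j zero | inj₂ _ = z≤n
unitSteps-bound {suc d} s j (suc c) | inj₂ i = unitSteps-bound (s ∘ suc) i c

≤-maxℕ : ∀ {n} (f : Fin n → ℕ) i → f i ≤ maxℕ f
≤-maxℕ f zero = ℕ.m≤m⊔n (f zero) _
≤-maxℕ f (suc i) = ℕ.≤-trans (≤-maxℕ (f ∘ suc) i) (ℕ.m≤n⊔m (f zero) _)

≤-sumℕ : ∀ {n} (f : Fin n → ℕ) i → f i ≤ sumℕ f
≤-sumℕ f zero = ℕ.m≤m+n (f zero) _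
≤-sumℕ f (suc i) = ℕ.≤-trans (≤-sumℕ (f ∘ suc) i) (ℕ.m≤n+m _ (f zero))

sumℕ-zero : ∀ {n} (f : Fin n → ℕ) → (∀ i → f i ≡ 0) → sumℕ f ≡ 0
sumℕ-zero {zero} f f≡0 = refl
sumℕ-zero {suc n} f f≡0 = cong₂ _+_ (f≡0 zero) (sumℕ-zero (f ∘ suc) (f≡0 ∘ suc))

Represents : ∀ {d k} → (Fin k → ℤVec d) → Mask k → Set
Represents z J = ∀ c → ℤΣ.∑⟨ J ⟩ (λ j → z j c) ≡ sumVec z c

module _ {d k : ℕ} (z : Fin k → ℤVec d) (M : ℕ) (1≤M : 1 ≤ M) (∣z∣≤M : ∀ j c → ℤ.∣ z j c ∣ ≤ M) where

  private
    s = sumVec z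
    u = norm1 s

  -- Appending the unit steps of -s to a representing J gives a zero-sum family T; a zero-sum
  -- subfamily avoiding all unit steps is a zero-sum subfamily of J.
  zeroSum-within : ∀ {J} → Represents z J → suc u * suc (M * d + M * d) ^ d ≤ count J →
    ∃ λ I → I ⊆ J × (∃ λ j → I j ≡ true) × (∀ c → ℤΣ.∑⟨ I ⟩ (λ j → z j c) ≡ 0ℤ)
  zeroSum-within {J} J-rep big = restrict (zeroSum-avoiding T U T-zero few-classes)
    where
    w : Fin (k + u) → ℤVec d
    w = z ++ unitSteps s
    ∣w∣≤M : ∀ i c → ℤ.∣ w i c ∣ ≤ M
    ∣w∣≤M i c with splitAt k i
    ... | inj₁ j = ∣z∣≤M j c
    ... | inj₂ j = ℕ.≤-trans (unitSteps-bound s j c) 1≤M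
    open ZeroSumSubset w M ∣w∣≤M
    T U : Mask (k + u)
    T = J ++ const true
    U = const {B = Fin k} false ++ const true
    T-zero : ∀ c → columnSum T c ≡ 0ℤ
    T-zero c = begin
      columnSum T c                                                ≡⟨ ℤΣ.sum-↑ {k} _ ⟩
      ℤΣ.∑⟨ T ∘ (_↑ˡ u) ⟩ (λ j → w (j ↑ˡ u) c) ℤ.+ ℤΣ.∑⟨ T ∘ (k ↑ʳ_) ⟩ (λ j → w (k ↑ʳ j) c)
        ≡⟨ cong₂ ℤ._+_ (ℤΣ.∑⟨⟩-cong (lookup-++ˡ J _) (λ j → cong (λ v → v c) (lookup-++ˡ z _ j)))
                       (ℤΣ.∑⟨⟩-cong (lookup-++ʳ J (const true)) (λ j → cong (λ v → v c) (lookup-++ʳ z (unitSteps s) j))) ⟩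
      ℤΣ.∑⟨ J ⟩ (λ j → z j c) ℤ.+ ℤΣ.sum (λ j → unitSteps s j c) ≡⟨ cong₂ ℤ._+_ (J-rep c) (unitSteps-sum s c) ⟩
      s c ℤ.+ ℤ.- s c                                              ≡⟨ ℤ.+-inverseʳ (s c) ⟩
      0ℤ                                                           ∎
      where open ≡-Reasoning
    few-classes : suc (count U) * suc (R + R) ^ d < suc (count T)
    few-classes = s≤s (subst₂ (λ a b → suc a * suc (R + R) ^ d ≤ b) (sym ∣U∣) (sym ∣T∣) (ℕ.≤-trans big (ℕ.m≤m+n (count J) u)))
      where
      ∣T∣ : count T ≡ count J + u
      ∣T∣ = trans (count-++ J (const true)) (cong (_+_ (count J)) (count-full u))
      ∣U∣ : count U ≡ u
      ∣U∣ = trans (count-++ {k} (const false) (const true)) (cong₂ _+_ (count-∅ k) (count-full u))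
    restrict : (∃ λ D → D ⊆ T × (∀ i → D i ≡ true → U i ≡ false) × (∃ λ i → D i ≡ true) × (∀ c → columnSum D c ≡ 0ℤ)) →
      ∃ λ I → I ⊆ J × (∃ λ j → I j ≡ true) × (∀ c → ℤΣ.∑⟨ I ⟩ (λ j → z j c) ≡ 0ℤ)
    restrict (D , D⊆T , avoids-U , (i₀ , Di₀) , D-zero) = I , I⊆J , I-nonempty , I-zero
      where
      I : Mask k
      I j = D (j ↑ˡ u)
      I⊆J : I ⊆ J
      I⊆J j Ij = trans (sym (lookup-++ˡ J _ j)) (D⊆T (j ↑ˡ u) Ij)
      unit-free : ∀ j → D (k ↑ʳ j) ≡ false
      unit-free j with D (k ↑ʳ j) in Dj
      ... | false = refl
      ... | true = contradiction (trans (sym (avoids-U (k ↑ʳ j) Dj)) (lookup-++ʳ (const {B = Fin k} false) (const true) j))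
                                 λ ()
      I-nonempty : ∃ λ j → I j ≡ true
      I-nonempty with splitAt k i₀ in split
      ... | inj₁ j = j , subst (λ i → D i ≡ true) (sym (Fin.splitAt⁻¹-↑ˡ split)) Di₀
      ... | inj₂ j = contradiction (trans (sym (subst (λ i → D i ≡ true) (sym (Fin.splitAt⁻¹-↑ʳ split)) Di₀)) (unit-free j))
                                   λ ()
      I-zero : ∀ c → ℤΣ.∑⟨ I ⟩ (λ j → z j c) ≡ 0ℤ
      I-zero c = begin
        ℤΣ.∑⟨ I ⟩ (λ j → z j c)                ≡⟨ ℤ.+-identityʳ _ ⟨
        ℤΣ.∑⟨ I ⟩ (λ j → z j c) ℤ.+ 0ℤ
          ≡⟨ cong₂ ℤ._+_ (ℤΣ.∑⟨⟩-cong (λ _ → refl) (λ j → cong (λ v → v c) (lookup-++ˡ z _ j)))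
                         (trans (ℤΣ.∑⟨⟩-cong unit-free (λ _ → refl)) (ℤΣ.∑⟨∅⟩ (λ j → w (k ↑ʳ j) c))) ⟨
        ℤΣ.∑⟨ D ∘ (_↑ˡ u) ⟩ (λ j → w (j ↑ˡ u) c) ℤ.+ ℤΣ.∑⟨ D ∘ (k ↑ʳ_) ⟩ (λ j → w (k ↑ʳ j) c)
          ≡⟨ ℤΣ.sum-↑ {k} _ ⟨
        columnSum D c                          ≡⟨ D-zero c ⟩
        0ℤ                                     ∎
        where open ≡-Reasoning

  shrink : ∀ {J} → Represents z J → suc u * suc (M * d + M * d) ^ d ≤ count J →
    ∃ λ J′ → Represents z J′ × count J′ < count J
  shrink {J} J-rep big = remove (zeroSum-within J-rep big)
    where
    remove : (∃ λ I → I ⊆ J × (∃ λ j → I j ≡ true) × (∀ c → ℤΣ.∑⟨ I ⟩ (λ j → z j c) ≡ 0ℤ)) →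
      ∃ λ J′ → Represents z J′ × count J′ < count J
    remove (I , I⊆J , (j , Ij) , I-zero) = J ∖ I , rep , count-∖-< {A = J} I⊆J Ij
      where
      rep : Represents z (J ∖ I)
      rep c = begin
        ℤΣ.∑⟨ J ∖ I ⟩ (λ j → z j c)                              ≡⟨ ℤ.+-identityʳ _ ⟨
        ℤΣ.∑⟨ J ∖ I ⟩ (λ j → z j c) ℤ.+ 0ℤ                       ≡⟨ cong (ℤ._+_ (ℤΣ.∑⟨ J ∖ I ⟩ (λ j → z j c))) (I-zero c) ⟨
        ℤΣ.∑⟨ J ∖ I ⟩ (λ j → z j c) ℤ.+ ℤΣ.∑⟨ I ⟩ (λ j → z j c) ≡⟨ ℤΣ.∑⟨⟩-∖ (λ j → z j c) I⊆J ⟨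
        ℤΣ.∑⟨ J ⟩ (λ j → z j c)                                  ≡⟨ J-rep c ⟩
        sumVec z c                                               ∎
        where open ≡-Reasoning

pigeonhole-bound : ∀ u d M → 1 ≤ u → 1 ≤ M * d →
  suc u * suc (M * d + M * d) ^ d ≤ 2 * u * (3 * d * M) ^ d
pigeonhole-bound u d M 1≤u 1≤R = ℕ.*-mono-≤
  (subst (suc u ≤_) (solve 1 (λ u → u :+ u := con 2 :* u) refl u) (ℕ.+-monoˡ-≤ u 1≤u))
  (ℕ.^-monoˡ-≤ d (subst (suc (R + R) ≤_) (solve 2 (λ d M → M :* d :+ (M :* d :+ M :* d) := con 3 :* d :* M) refl d M)
                                        (ℕ.+-monoˡ-≤ (R + R) 1≤R)))
  where
  open +-*-Solver
  R = M * d

norm1≢0⇒1≤d : ∀ {d} (s : ℤVec d) → norm1 s ≢ 0 → 1 ≤ d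
norm1≢0⇒1≤d {zero} s ∣s∣≢0 = contradiction refl ∣s∣≢0
norm1≢0⇒1≤d {suc d} s _ = s≤s z≤n

module _ {d k : ℕ} (z : Fin k → ℤVec d) where

  private
    s = sumVec z
    u = norm1 s
    M = maxℕ (λ j → normInf (z j))

  ∣z∣≤M : ∀ j c → ℤ.∣ z j c ∣ ≤ M
  ∣z∣≤M j c = ℕ.≤-trans (≤-maxℕ (λ c → ℤ.∣ z j c ∣) c) (≤-maxℕ (λ j → normInf (z j)) j)

  all-represents : Represents z (const true)
  all-represents c = sym (sumVec-columns z c)

  norm1≢0⇒1≤M : u ≢ 0 → 1 ≤ M
  norm1≢0⇒1≤M u≢0 = ℕ.n≢0⇒n>0 λ M≡0 → u≢0 (sumℕ-zero _ λ c → cong ℤ.∣_∣ (s≡0 M≡0 c))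
    where
    s≡0 : M ≡ 0 → ∀ c → s c ≡ 0ℤ
    s≡0 M≡0 c = trans (sumVec-columns z c) (trans (ℤΣ.sum-cong-≗ {k} z≡0) (ℤΣ.sum-replicate-zero k))
      where
      z≡0 : ∀ j → z j c ≡ 0ℤ
      z≡0 j = ℤ.∣i∣≡0⇒i≡0 (ℕ.n≤0⇒n≡0 (subst (ℤ.∣ z j c ∣ ≤_) M≡0 (∣z∣≤M j c)))

  small-representation : ∃ λ J → Represents z J × count J ≤ 2 * u * (3 * d * M) ^ d
  small-representation with u ℕ.≟ 0
  ... | yes u≡0 = const false , empty-represents , subst (_≤ 2 * u * (3 * d * M) ^ d) (sym (count-∅ k)) z≤n
    where
    empty-represents : Represents z (const false)
    empty-represents c = trans (ℤΣ.∑⟨∅⟩ (λ j → z j c))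
      (sym (ℤ.∣i∣≡0⇒i≡0 (ℕ.n≤0⇒n≡0 (subst (ℤ.∣ s c ∣ ≤_) u≡0 (≤-sumℕ (λ c → ℤ.∣ s c ∣) c)))))
  ... | no u≢0 = descend (Represents z) count _ step (const true) all-represents
    where
    1≤M = norm1≢0⇒1≤M u≢0
    step : ∀ J → Represents z J → 2 * u * (3 * d * M) ^ d < count J → ∃ λ J′ → Represents z J′ × count J′ < count J
    step J J-rep big = shrink z M 1≤M ∣z∣≤M J-rep (ℕ.≤-trans (pigeonhole-bound u d M (ℕ.n≢0⇒n>0 u≢0)
      (ℕ.*-mono-≤ 1≤M (norm1≢0⇒1≤d s u≢0))) (ℕ.<⇒≤ big))

corollary18 : (d k : ℕ) → (z : Fin k → ℤVec d) →
    ∃[ J ] (((i : Fin d) → sumVec z i ≡ sumOver J z i) ×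
      (∣ J ∣ ≤ 2 * norm1 (sumVec z) * (3 * d * maxℕ (λ j → normInf (z j))) ^ d))
corollary18 d k z = tabulate J , represents ,
  subst (_≤ 2 * norm1 (sumVec z) * (3 * d * maxℕ (λ j → normInf (z j))) ^ d) (sym (∣tabulate∣ J)) ∣J∣≤
  where
  J = proj₁ (small-representation z)
  ∣J∣≤ = proj₂ (proj₂ (small-representation z))
  represents : ∀ c → sumVec z c ≡ sumOver (tabulate J) z c
  represents c = sym (trans (sumOver-columns (tabulate J) z c)
    (trans (ℤΣ.∑⟨⟩-cong (lookup∘tabulate J) (λ _ → refl)) (proj₁ (proj₂ (small-representation z)) c)))
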